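{- Let $N\geq5$ be odd. For a polynomial $F\in\mathbb{Q}[X]$ write $L_F(X)=F(X)-F(1+X)-X^{N-2}F(1+\frac{1}{X})$. If $C(X)=\sum_{n=1}^{(N-3)/2}c_{n}X^{2n}\in\mathbb{Q}[X]$ satisfies $L_C(X)=(\text{constant})+(\text{an odd polynomial in }X)$, and $p$ is defined by $Xp(X)=XC'(X)+X^{N-2}C'(\frac{1}{X})$, then \[ Xp(X)-(1+X)p(1+X)-X^{N-2}\Big(1+\frac{1}{X}\Big)p\Big(1+\frac{1}{X}\Big)=(\text{constant})+(\text{an odd polynomial in }X). \]
   Context: $C'$ denotes the derivative of $C$. -}

module Defs where

open import Data.Nat as ℕ using (ℕ; zero; suc; _∸_)
open import Data.Integer using (+_)
open import Data.Rational using (ℚ; 0ℚ; 1ℚ; _+_; _*_; -_; _/_)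
open import Data.List using (List; []; _∷_; replicate; _++_)
open import Relation.Binary.PropositionalEquality using (_≡_)
open import Data.Product using (Σ; _×_)

-- Polynomials in ℚ[X] as coefficient lists, lowest degree first.
-- (Trailing zeros allowed; equality of polynomials is equality of all coefficients.)
Poly : Set
Poly = List ℚ

coeff : Poly → ℕ → ℚ
coeff []       _       = 0ℚ
coeff (a ∷ p)  zero    = a
coeff (a ∷ p)  (suc n) = coeff p n

infix 4 _≈ₚ_
_≈ₚ_ : Poly → Poly → Set
p ≈ₚ q = ∀ n → coeff p n ≡ coeff q n

const : ℚ → Poly
const a = a ∷ []

Xₚ : Poly
Xₚ = 0ℚ ∷ 1ℚ ∷ []

1+X : Poly
1+X = 1ℚ ∷ 1ℚ ∷ []

infixl 6 _⊕_ _⊖_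
infixl 7 _⊗_

_⊕_ : Poly → Poly → Poly
[]      ⊕ q       = q
(a ∷ p) ⊕ []      = a ∷ p
(a ∷ p) ⊕ (b ∷ q) = (a + b) ∷ (p ⊕ q)

scale : ℚ → Poly → Poly
scale c []      = []
scale c (a ∷ p) = (c * a) ∷ scale c p

negₚ : Poly → Poly
negₚ = scale (- 1ℚ)

_⊖_ : Poly → Poly → Poly
p ⊖ q = p ⊕ negₚ q

_⊗_ : Poly → Poly → Poly
[]      ⊗ q = []
(a ∷ p) ⊗ q = scale a q ⊕ (0ℚ ∷ (p ⊗ q))

Xpow : ℕ → Poly → Poly
Xpow k p = replicate k 0ℚ ++ p

powₚ : Poly → ℕ → Poly
powₚ p zero    = 1ℚ ∷ []
powₚ p (suc k) = p ⊗ powₚ p k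

_∘ₚ_ : Poly → Poly → Poly
[]      ∘ₚ g = []
(a ∷ p) ∘ₚ g = const a ⊕ (g ⊗ (p ∘ₚ g))

derivFrom : ℕ → Poly → Poly
derivFrom k []      = []
derivFrom k (a ∷ p) = ((+ k / 1) * a) ∷ derivFrom (suc k) p

deriv : Poly → Poly
deriv []      = []
deriv (a ∷ p) = derivFrom 1 p

-- X^m · F(1/X) = Σ a_k X^(m-k); a polynomial whenever deg F ≤ m
-- (only used under that condition).
recipFrom : ℕ → ℕ → Poly → Poly
recipFrom m k []      = []
recipFrom m k (a ∷ p) = Xpow (m ∸ k) (const a) ⊕ recipFrom m (suc k) p

recip : ℕ → Poly → Poly
recip m F = recipFrom m 0 F

-- X^m · F(1 + 1/X) = Σ a_k X^(m-k) (1+X)^k; a polynomial whenever deg F ≤ m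
-- (only used under that condition).
recipShiftFrom : ℕ → ℕ → Poly → Poly
recipShiftFrom m k []      = []
recipShiftFrom m k (a ∷ p) =
  scale a (Xpow (m ∸ k) (powₚ 1+X k)) ⊕ recipShiftFrom m (suc k) p

recipShift : ℕ → Poly → Poly
recipShift m F = recipShiftFrom m 0 F

L : ℕ → Poly → Poly
L N F = F ⊖ (F ∘ₚ 1+X) ⊖ recipShift (N ∸ 2) F

OddPoly : Poly → Set
OddPoly q = ∀ k → coeff q (2 ℕ.* k) ≡ 0ℚ

ConstPlusOdd : Poly → Set
ConstPlusOdd P = Σ ℚ λ a → Σ Poly λ q → OddPoly q × (P ≈ₚ const a ⊕ q)

-- Σ_{n=1}^{K} c_n X^(2n) from the list [c_1, …, c_K]
evenPolyFrom : List ℚ → Poly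
evenPolyFrom []      = []
evenPolyFrom (c ∷ cs) = 0ℚ ∷ c ∷ evenPolyFrom cs

evenPoly : List ℚ → Poly
evenPoly cs = 0ℚ ∷ evenPolyFrom cs

-- Homogenise: write h(s,t) = t^(N-2) C(s/t) and d(s,t) = t^(N-3) C′(s/t).
-- Then L turns a polynomial F with homogenisation f into
-- f(s,t) - f(s+t,t) - f(s+t,s), and X p(X) homogenises to
-- s (d(s,t) + d(t,s)).  The hypothesis on L_C says that the even part (in s)
-- of this expression for h is a constant multiple of t^(N-2); differentiating
-- it in s, with Euler's identity for h, says that a certain combination of
-- values of d and h is even.  Nine instances of these relations, at x, x ± 1
-- and the reflected points, combine linearly into the same statement for
-- s (d(s,t) + d(t,s)); holding at every natural x, it forces the even part of
-- L applied to X p to be constant.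
{-# OPTIONS --safe #-}
module Submission where

open import Defs
open import Data.Nat as ℕ using (ℕ; zero; suc; z≤n; s≤s; _≤_; _∸_; _%_; _/_)
import Data.Nat.Properties as ℕ
import Data.Nat.DivMod as ℕ
open import Data.Nat.Coprimality using (1-coprimeTo) renaming (sym to coprime-sym)
import Data.Integer as ℤ
open import Data.Rational using (ℚ; 0ℚ; 1ℚ; _+_; _*_; -_; _-_; mkℚ; 1/_; ≢-nonZero)
import Data.Rational as ℚ
import Data.Rational.Properties as ℚ
import Data.Rational.Unnormalised as ℚᵘ
import Data.Rational.Unnormalised.Properties as ℚᵘ
open import Data.List using ([]; _∷_; drop; length)
open import Data.Vec using (Vec; toList)
import Data.Vec.Properties as Vec
open import Data.Maybe using (Maybe; just; nothing)
open import Data.Product using (_,_)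
open import Data.Sum using (inj₁; inj₂)
open import Level using (0ℓ)
open import Relation.Nullary using (yes; no)
open import Relation.Binary.PropositionalEquality
  using (_≡_; _≢_; refl; sym; trans; cong; cong₂; subst; module ≡-Reasoning)
open ≡-Reasoning
import Tactic.RingSolver.Core.AlmostCommutativeRing as ACR
open import Tactic.RingSolver using (solve-∀)
import Data.Integer.Tactic.RingSolver as ℤ-Solver

ℚ-ring : ACR.AlmostCommutativeRing 0ℓ 0ℓ
ℚ-ring = ACR.fromCommutativeRing ℚ.+-*-commutativeRing isZero
  where
  isZero : ∀ x → Maybe (0ℚ ≡ x)
  isZero x with 0ℚ ℚ.≟ x
  ... | yes 0≡x = just 0≡x
  ... | no _    = nothing

two : ℚ
two = 1ℚ + 1ℚ

p*q≡0⇒q≡0 : ∀ p q → p ≢ 0ℚ → p * q ≡ 0ℚ → q ≡ 0ℚ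
p*q≡0⇒q≡0 p q p≢0 pq≡0 = begin
  q                 ≡⟨ sym (ℚ.*-identityˡ q) ⟩
  1ℚ * q            ≡⟨ cong (_* q) (sym (ℚ.*-inverseˡ p)) ⟩
  1/ p * p * q      ≡⟨ ℚ.*-assoc (1/ p) p q ⟩
  1/ p * (p * q)    ≡⟨ cong (1/ p *_) pq≡0 ⟩
  1/ p * 0ℚ         ≡⟨ ℚ.*-zeroʳ (1/ p) ⟩
  0ℚ                ∎
  where instance _ = ≢-nonZero p≢0

-- The form in which derivFrom writes its factors.
fromℕ : ℕ → ℚ
fromℕ k = ℤ.+ k ℚ./ 1

fromℕ≡mkℚ : ∀ k → fromℕ k ≡ mkℚ (ℤ.+ k) 0 (coprime-sym (1-coprimeTo k))
fromℕ≡mkℚ k = ℚ.normalize-coprime (coprime-sym (1-coprimeTo k))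

fromℕ-suc : ∀ k → fromℕ (suc k) ≡ 1ℚ + fromℕ k
fromℕ-suc k rewrite fromℕ≡mkℚ (suc k) | fromℕ≡mkℚ k =
  ℚ.toℚᵘ-injective (ℚᵘ.≃-trans (ℚᵘ.*≡* (identity (ℤ.+ k))) (ℚᵘ.≃-sym (ℚ.toℚᵘ-homo-+ 1ℚ k/1)))
  where
  k/1 = mkℚ (ℤ.+ k) 0 (coprime-sym (1-coprimeTo k))
  identity : ∀ z → (ℤ.+ 1 ℤ.+ z) ℤ.* ℤ.+ 1 ≡ (ℤ.+ 1 ℤ.* ℤ.+ 1 ℤ.+ z ℤ.* ℤ.+ 1) ℤ.* ℤ.+ 1
  identity = ℤ-Solver.solve-∀

fromℕ-+ : ∀ i j → fromℕ (i ℕ.+ j) ≡ fromℕ i + fromℕ j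
fromℕ-+ zero    j = sym (ℚ.+-identityˡ (fromℕ j))
fromℕ-+ (suc i) j = begin
  fromℕ (suc (i ℕ.+ j))     ≡⟨ fromℕ-suc (i ℕ.+ j) ⟩
  1ℚ + fromℕ (i ℕ.+ j)      ≡⟨ cong (1ℚ +_) (fromℕ-+ i j) ⟩
  1ℚ + (fromℕ i + fromℕ j)  ≡⟨ sym (ℚ.+-assoc 1ℚ (fromℕ i) (fromℕ j)) ⟩
  (1ℚ + fromℕ i) + fromℕ j  ≡⟨ cong (_+ fromℕ j) (sym (fromℕ-suc i)) ⟩
  fromℕ (suc i) + fromℕ j   ∎

fromℕ-suc≢0 : ∀ k → fromℕ (suc k) ≢ 0ℚ
fromℕ-suc≢0 k eq with trans (sym (fromℕ≡mkℚ (suc k))) eq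
... | ()

infixr 8 _^_

-- Opaque, so that unification treats powers as atoms instead of unfolding
-- them into products of rational literals.
opaque
  _^_ : ℚ → ℕ → ℚ
  x ^ zero  = 1ℚ
  x ^ suc n = x * x ^ n

  ^-zero : ∀ x → x ^ zero ≡ 1ℚ
  ^-zero x = refl

  ^-suc : ∀ x n → x ^ suc n ≡ x * x ^ n
  ^-suc x n = refl

1^n≡1 : ∀ n → 1ℚ ^ n ≡ 1ℚ
1^n≡1 zero    = ^-zero 1ℚ
1^n≡1 (suc n) = trans (^-suc 1ℚ n) (trans (cong (1ℚ *_) (1^n≡1 n)) (ℚ.*-identityˡ 1ℚ))

≈ₚ-trans : ∀ {P Q R} → P ≈ₚ Q → Q ≈ₚ R → P ≈ₚ R
≈ₚ-trans P≈Q Q≈R n = trans (P≈Q n) (Q≈R n)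

∷-cong : ∀ a {P Q} → P ≈ₚ Q → a ∷ P ≈ₚ a ∷ Q
∷-cong a P≈Q zero    = refl
∷-cong a P≈Q (suc n) = P≈Q n

coeff-drop1 : ∀ P n → coeff (drop 1 P) n ≡ coeff P (suc n)
coeff-drop1 []      n = refl
coeff-drop1 (a ∷ P) n = refl

coeff-⊕ : ∀ P Q n → coeff (P ⊕ Q) n ≡ coeff P n + coeff Q n
coeff-⊕ []      Q       n       = sym (ℚ.+-identityˡ _)
coeff-⊕ (a ∷ P) []      n       = sym (ℚ.+-identityʳ _)
coeff-⊕ (a ∷ P) (b ∷ Q) zero    = refl
coeff-⊕ (a ∷ P) (b ∷ Q) (suc n) = coeff-⊕ P Q n

coeff-scale : ∀ c P n → coeff (scale c P) n ≡ c * coeff P n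
coeff-scale c []      n       = sym (ℚ.*-zeroʳ c)
coeff-scale c (a ∷ P) zero    = refl
coeff-scale c (a ∷ P) (suc n) = coeff-scale c P n

coeff-negₚ : ∀ P n → coeff (negₚ P) n ≡ - coeff P n
coeff-negₚ P n = trans (coeff-scale (- 1ℚ) P n) (-1*x≡-x (coeff P n))
  where
  -1*x≡-x : ∀ x → - 1ℚ * x ≡ - x
  -1*x≡-x = solve-∀ ℚ-ring

coeff-⊖ : ∀ P Q n → coeff (P ⊖ Q) n ≡ coeff P n - coeff Q n
coeff-⊖ P Q n = trans (coeff-⊕ P (negₚ Q) n) (cong (coeff P n +_) (coeff-negₚ Q n))

⊕-cong : ∀ {P P′ Q Q′} → P ≈ₚ P′ → Q ≈ₚ Q′ → P ⊕ Q ≈ₚ P′ ⊕ Q′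
⊕-cong {P} {P′} {Q} {Q′} P≈P′ Q≈Q′ n =
  trans (coeff-⊕ P Q n) (trans (cong₂ _+_ (P≈P′ n) (Q≈Q′ n)) (sym (coeff-⊕ P′ Q′ n)))

⊖-cong : ∀ {P P′ Q Q′} → P ≈ₚ P′ → Q ≈ₚ Q′ → P ⊖ Q ≈ₚ P′ ⊖ Q′
⊖-cong {P} {P′} {Q} {Q′} P≈P′ Q≈Q′ n =
  trans (coeff-⊖ P Q n) (trans (cong₂ _-_ (P≈P′ n) (Q≈Q′ n)) (sym (coeff-⊖ P′ Q′ n)))

1⊗-≈ : ∀ P → (1ℚ ∷ []) ⊗ P ≈ₚ P
1⊗-≈ P n = trans (coeff-⊕ (scale 1ℚ P) (0ℚ ∷ []) n)
                 (trans (cong₂ _+_ (coeff-scale 1ℚ P n) (coeff-0 n)) (1*x+0≡x (coeff P n)))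
  where
  coeff-0 : ∀ n → coeff (0ℚ ∷ []) n ≡ 0ℚ
  coeff-0 zero    = refl
  coeff-0 (suc n) = refl
  1*x+0≡x : ∀ x → 1ℚ * x + 0ℚ ≡ x
  1*x+0≡x = solve-∀ ℚ-ring

X⊗-≈ : ∀ P → Xₚ ⊗ P ≈ₚ 0ℚ ∷ P
X⊗-≈ P n = begin
  coeff (scale 0ℚ P ⊕ (0ℚ ∷ (1ℚ ∷ []) ⊗ P)) n
    ≡⟨ coeff-⊕ (scale 0ℚ P) _ n ⟩
  coeff (scale 0ℚ P) n + coeff (0ℚ ∷ (1ℚ ∷ []) ⊗ P) n
    ≡⟨ cong₂ _+_ (scale-0 n) (∷-cong 0ℚ (1⊗-≈ P) n) ⟩
  0ℚ + coeff (0ℚ ∷ P) n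
    ≡⟨ ℚ.+-identityˡ _ ⟩
  coeff (0ℚ ∷ P) n ∎
  where
  scale-0 : ∀ n → coeff (scale 0ℚ P) n ≡ 0ℚ
  scale-0 n = trans (coeff-scale 0ℚ P n) (ℚ.*-zeroˡ (coeff P n))

1+X⊗-≈ : ∀ P → 1+X ⊗ P ≈ₚ P ⊕ (0ℚ ∷ P)
1+X⊗-≈ P n = begin
  coeff (scale 1ℚ P ⊕ (0ℚ ∷ Xₚ′)) n     ≡⟨ coeff-⊕ (scale 1ℚ P) (0ℚ ∷ Xₚ′) n ⟩
  coeff (scale 1ℚ P) n + coeff (0ℚ ∷ Xₚ′) n
    ≡⟨ cong₂ _+_ (trans (coeff-scale 1ℚ P n) (ℚ.*-identityˡ (coeff P n))) (∷-cong 0ℚ (1⊗-≈ P) n) ⟩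
  coeff P n + coeff (0ℚ ∷ P) n           ≡⟨ sym (coeff-⊕ P (0ℚ ∷ P) n) ⟩
  coeff (P ⊕ (0ℚ ∷ P)) n                 ∎
  where Xₚ′ = (1ℚ ∷ []) ⊗ P

coeff-1+X⊗-zero : ∀ P → coeff (1+X ⊗ P) 0 ≡ coeff P 0
coeff-1+X⊗-zero P = trans (1+X⊗-≈ P 0) (trans (coeff-⊕ P (0ℚ ∷ P) 0) (ℚ.+-identityʳ _))

coeff-1+X⊗-suc : ∀ P k → coeff (1+X ⊗ P) (suc k) ≡ coeff P (suc k) + coeff P k
coeff-1+X⊗-suc P k = trans (1+X⊗-≈ P (suc k)) (coeff-⊕ P (0ℚ ∷ P) (suc k))

-- Polynomials with all coefficients zero, and degree bounds

⊕-null : ∀ P Q → P ≈ₚ [] → Q ≈ₚ [] → P ⊕ Q ≈ₚ []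
⊕-null P Q P≈0 Q≈0 k =
  trans (coeff-⊕ P Q k) (trans (cong₂ _+_ (P≈0 k) (Q≈0 k)) (ℚ.+-identityʳ 0ℚ))

scale-null : ∀ {a} P → a ≡ 0ℚ → scale a P ≈ₚ []
scale-null {a} P a≡0 k =
  trans (coeff-scale a P k) (trans (cong (_* coeff P k) a≡0) (ℚ.*-zeroˡ (coeff P k)))

1+X⊗-null : ∀ P → P ≈ₚ [] → 1+X ⊗ P ≈ₚ []
1+X⊗-null P P≈0 zero    = trans (coeff-1+X⊗-zero P) (P≈0 0)
1+X⊗-null P P≈0 (suc k) =
  trans (coeff-1+X⊗-suc P k) (trans (cong₂ _+_ (P≈0 (suc k)) (P≈0 k)) (ℚ.+-identityʳ 0ℚ))

Xpow-null : ∀ j P → P ≈ₚ [] → Xpow j P ≈ₚ []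
Xpow-null zero    P P≈0         = P≈0
Xpow-null (suc j) P P≈0 zero    = refl
Xpow-null (suc j) P P≈0 (suc i) = Xpow-null j P P≈0 i

∘1+X-null : ∀ F → F ≈ₚ [] → F ∘ₚ 1+X ≈ₚ []
∘1+X-null []      F≈0 = λ _ → refl
∘1+X-null (a ∷ F) F≈0 =
  ⊕-null (const a) (1+X ⊗ (F ∘ₚ 1+X)) a≈0 (1+X⊗-null (F ∘ₚ 1+X) (∘1+X-null F (λ j → F≈0 (suc j))))
  where
  a≈0 : const a ≈ₚ []
  a≈0 zero    = F≈0 0
  a≈0 (suc k) = refl

recipFrom-null : ∀ m k F → F ≈ₚ [] → recipFrom m k F ≈ₚ []
recipFrom-null m k []      F≈0 = λ _ → refl
recipFrom-null m k (a ∷ F) F≈0 =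
  ⊕-null (Xpow (m ∸ k) (const a)) (recipFrom m (suc k) F)
    (Xpow-null (m ∸ k) (const a) a≈0) (recipFrom-null m (suc k) F (λ j → F≈0 (suc j)))
  where
  a≈0 : const a ≈ₚ []
  a≈0 zero    = F≈0 0
  a≈0 (suc k) = refl

recipShiftFrom-null : ∀ m k F → F ≈ₚ [] → recipShiftFrom m k F ≈ₚ []
recipShiftFrom-null m k []      F≈0 = λ _ → refl
recipShiftFrom-null m k (a ∷ F) F≈0 =
  ⊕-null (scale a T) (recipShiftFrom m (suc k) F)
    (scale-null T (F≈0 0)) (recipShiftFrom-null m (suc k) F (λ j → F≈0 (suc j)))
  where T = Xpow (m ∸ k) (powₚ 1+X k)

Deg≤ : ℕ → Poly → Set
Deg≤ n P = ∀ k → n ℕ.< k → coeff P k ≡ 0ℚ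

Deg≤-length : ∀ n P → length P ≤ suc n → Deg≤ n P
Deg≤-length n       []          _            k       _         = refl
Deg≤-length zero    (a ∷ [])    _            (suc k) _         = refl
Deg≤-length zero    (a ∷ b ∷ P) (s≤s ())
Deg≤-length (suc n) (a ∷ P)     (s≤s |P|≤n)  (suc k) (s≤s n<k) = Deg≤-length n P |P|≤n k n<k

Deg≤-drop1 : ∀ n P → Deg≤ (suc n) P → Deg≤ n (drop 1 P)
Deg≤-drop1 n P P≤ k n<k = trans (coeff-drop1 P k) (P≤ (suc k) (s≤s n<k))

Deg≤0⇒drop1-null : ∀ P → Deg≤ 0 P → drop 1 P ≈ₚ []
Deg≤0⇒drop1-null P P≤ k = trans (coeff-drop1 P k) (P≤ (suc k) (s≤s z≤n))

Deg≤-mono : ∀ {m n} P → m ≤ n → Deg≤ m P → Deg≤ n P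
Deg≤-mono P m≤n P≤ k n<k = P≤ k (ℕ.≤-<-trans m≤n n<k)

Deg≤-resp-≈ : ∀ n P Q → P ≈ₚ Q → Deg≤ n Q → Deg≤ n P
Deg≤-resp-≈ n P Q P≈Q Q≤ k n<k = trans (P≈Q k) (Q≤ k n<k)

Deg≤-⊕ : ∀ n P Q → Deg≤ n P → Deg≤ n Q → Deg≤ n (P ⊕ Q)
Deg≤-⊕ n P Q P≤ Q≤ k n<k =
  trans (coeff-⊕ P Q k) (trans (cong₂ _+_ (P≤ k n<k) (Q≤ k n<k)) (ℚ.+-identityʳ 0ℚ))

Deg≤-scale : ∀ n c P → Deg≤ n P → Deg≤ n (scale c P)
Deg≤-scale n c P P≤ k n<k = trans (coeff-scale c P k) (trans (cong (c *_) (P≤ k n<k)) (ℚ.*-zeroʳ c))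

Deg≤-⊖ : ∀ n P Q → Deg≤ n P → Deg≤ n Q → Deg≤ n (P ⊖ Q)
Deg≤-⊖ n P Q P≤ Q≤ = Deg≤-⊕ n P (negₚ Q) P≤ (Deg≤-scale n (- 1ℚ) Q Q≤)

Deg≤-const : ∀ n a → Deg≤ n (const a)
Deg≤-const n a (suc k) n<k = refl

Deg≤-X⊗ : ∀ n P → Deg≤ n P → Deg≤ (suc n) (Xₚ ⊗ P)
Deg≤-X⊗ n P P≤ (suc k) (s≤s n<k) = trans (X⊗-≈ P (suc k)) (P≤ k n<k)

Deg≤-Xpow : ∀ j n P → Deg≤ n P → Deg≤ (j ℕ.+ n) (Xpow j P)
Deg≤-Xpow zero    n P P≤                  = P≤
Deg≤-Xpow (suc j) n P P≤ (suc k) (s≤s lt) = Deg≤-Xpow j n P P≤ k lt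

Deg≤-1+X⊗ : ∀ n P → Deg≤ n P → Deg≤ (suc n) (1+X ⊗ P)
Deg≤-1+X⊗ n P P≤ (suc k) (s≤s n<k) = trans (coeff-1+X⊗-suc P k)
  (trans (cong₂ _+_ (P≤ (suc k) (ℕ.<-trans n<k (ℕ.n<1+n k))) (P≤ k n<k)) (ℚ.+-identityʳ 0ℚ))

Deg≤-powₚ-1+X : ∀ k → Deg≤ k (powₚ 1+X k)
Deg≤-powₚ-1+X zero    (suc k) _ = refl
Deg≤-powₚ-1+X (suc k)           = Deg≤-1+X⊗ k (powₚ 1+X k) (Deg≤-powₚ-1+X k)

Deg≤-∘1+X : ∀ n F → Deg≤ n F → Deg≤ n (F ∘ₚ 1+X)
Deg≤-∘1+X n       []      F≤ k       _  = refl
Deg≤-∘1+X zero    (a ∷ F) F≤ (suc k) lt = trans (coeff-⊕ (const a) (1+X ⊗ (F ∘ₚ 1+X)) (suc k))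
  (trans (cong (0ℚ +_) (1+X⊗-null (F ∘ₚ 1+X) (∘1+X-null F (Deg≤0⇒drop1-null (a ∷ F) F≤)) (suc k)))
         (ℚ.+-identityʳ 0ℚ))
Deg≤-∘1+X (suc n) (a ∷ F) F≤ (suc k) lt = trans (coeff-⊕ (const a) (1+X ⊗ (F ∘ₚ 1+X)) (suc k))
  (trans (cong (0ℚ +_) (Deg≤-1+X⊗ n (F ∘ₚ 1+X) (Deg≤-∘1+X n F (Deg≤-drop1 n (a ∷ F) F≤)) (suc k) lt))
         (ℚ.+-identityʳ 0ℚ))

Deg≤-recipFrom : ∀ m k F → Deg≤ m (recipFrom m k F)
Deg≤-recipFrom m k []      i _ = refl
Deg≤-recipFrom m k (a ∷ F) = Deg≤-⊕ m (Xpow (m ∸ k) (const a)) (recipFrom m (suc k) F)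
  (Deg≤-mono (Xpow (m ∸ k) (const a)) (subst (ℕ._≤ m) (sym (ℕ.+-identityʳ (m ∸ k))) (ℕ.m∸n≤m m k))
             (Deg≤-Xpow (m ∸ k) 0 (const a) (Deg≤-const 0 a)))
  (Deg≤-recipFrom m (suc k) F)

Deg≤-recipShiftFrom : ∀ m k F → (∀ i → m ℕ.< k ℕ.+ i → coeff F i ≡ 0ℚ) →
                      Deg≤ m (recipShiftFrom m k F)
Deg≤-recipShiftFrom m k []      F≤ i _ = refl
Deg≤-recipShiftFrom m k (a ∷ F) F≤ = Deg≤-⊕ m (scale a T) (recipShiftFrom m (suc k) F) T≤
  (Deg≤-recipShiftFrom m (suc k) F (λ i lt → F≤ (suc i) (subst (m ℕ.<_) (sym (ℕ.+-suc k i)) lt)))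
  where
  T = Xpow (m ∸ k) (powₚ 1+X k)
  T≤ : Deg≤ m (scale a T)
  T≤ with ℕ.≤-<-connex k m
  ... | inj₁ k≤m = Deg≤-scale m a T
        (subst (λ z → Deg≤ z T) (ℕ.m∸n+n≡m k≤m) (Deg≤-Xpow (m ∸ k) k (powₚ 1+X k) (Deg≤-powₚ-1+X k)))
  ... | inj₂ m<k = λ i _ → scale-null T (F≤ 0 (subst (m ℕ.<_) (sym (ℕ.+-identityʳ k)) m<k)) i

-- Homogenisation

-- hom n P s t = t^n P(s/t) = Σ_{k ≤ n} p_k s^k t^(n-k); coefficients
-- beyond degree n are ignored.
hom : ℕ → Poly → ℚ → ℚ → ℚ
hom n       []      s t = 0ℚ
hom zero    (a ∷ P) s t = a
hom (suc n) (a ∷ P) s t = a * t ^ suc n + s * hom n P s t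

hom-[] : ∀ n s t → hom n [] s t ≡ 0ℚ
hom-[] zero    s t = refl
hom-[] (suc n) s t = refl

hom-zero : ∀ P s t → hom zero P s t ≡ coeff P 0
hom-zero []      s t = refl
hom-zero (a ∷ P) s t = refl

hom-suc : ∀ n P s t → hom (suc n) P s t ≡ coeff P 0 * t ^ suc n + s * hom n (drop 1 P) s t
hom-suc n []      s t = sym (0*x+y*0≡0 (t ^ suc n) s)
  where
  0*x+y*0≡0 : ∀ x y → 0ℚ * x + y * 0ℚ ≡ 0ℚ
  0*x+y*0≡0 = solve-∀ ℚ-ring
hom-suc n (a ∷ P) s t = refl

hom-cong : ∀ n P Q s t → P ≈ₚ Q → hom n P s t ≡ hom n Q s t
hom-cong zero    P Q s t P≈Q = trans (hom-zero P s t) (trans (P≈Q 0) (sym (hom-zero Q s t)))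
hom-cong (suc n) P Q s t P≈Q = begin
  hom (suc n) P s t                                    ≡⟨ hom-suc n P s t ⟩
  coeff P 0 * t ^ suc n + s * hom n (drop 1 P) s t
    ≡⟨ cong₂ (λ u v → u * t ^ suc n + s * v) (P≈Q 0) (hom-cong n (drop 1 P) (drop 1 Q) s t drop-≈) ⟩
  coeff Q 0 * t ^ suc n + s * hom n (drop 1 Q) s t     ≡⟨ sym (hom-suc n Q s t) ⟩
  hom (suc n) Q s t                                    ∎
  where
  drop-≈ : drop 1 P ≈ₚ drop 1 Q
  drop-≈ k = trans (coeff-drop1 P k) (trans (P≈Q (suc k)) (sym (coeff-drop1 Q k)))

hom-null : ∀ n P s t → P ≈ₚ [] → hom n P s t ≡ 0ℚ
hom-null n P s t P≈0 = trans (hom-cong n P [] s t P≈0) (hom-[] n s t)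

hom-⊕ : ∀ n P Q s t → hom n (P ⊕ Q) s t ≡ hom n P s t + hom n Q s t
hom-⊕ n       []      Q       s t = sym (ℚ.+-identityˡ _)
hom-⊕ zero    (a ∷ P) []      s t = sym (ℚ.+-identityʳ a)
hom-⊕ (suc n) (a ∷ P) []      s t = sym (ℚ.+-identityʳ _)
hom-⊕ zero    (a ∷ P) (b ∷ Q) s t = refl
hom-⊕ (suc n) (a ∷ P) (b ∷ Q) s t = begin
  (a + b) * t ^ suc n + s * hom n (P ⊕ Q) s t
    ≡⟨ cong (λ z → (a + b) * t ^ suc n + s * z) (hom-⊕ n P Q s t) ⟩
  (a + b) * t ^ suc n + s * (hom n P s t + hom n Q s t)
    ≡⟨ distribute a b (t ^ suc n) s (hom n P s t) (hom n Q s t) ⟩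
  (a * t ^ suc n + s * hom n P s t) + (b * t ^ suc n + s * hom n Q s t) ∎
  where
  distribute : ∀ a b p s x y → (a + b) * p + s * (x + y) ≡ (a * p + s * x) + (b * p + s * y)
  distribute = solve-∀ ℚ-ring

hom-scale : ∀ n c P s t → hom n (scale c P) s t ≡ c * hom n P s t
hom-scale n       c []      s t = sym (ℚ.*-zeroʳ c)
hom-scale zero    c (a ∷ P) s t = refl
hom-scale (suc n) c (a ∷ P) s t = begin
  c * a * t ^ suc n + s * hom n (scale c P) s t
    ≡⟨ cong (λ z → c * a * t ^ suc n + s * z) (hom-scale n c P s t) ⟩
  c * a * t ^ suc n + s * (c * hom n P s t)
    ≡⟨ factor c a (t ^ suc n) s (hom n P s t) ⟩
  c * (a * t ^ suc n + s * hom n P s t) ∎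
  where
  factor : ∀ c a p s x → c * a * p + s * (c * x) ≡ c * (a * p + s * x)
  factor = solve-∀ ℚ-ring

hom-⊖ : ∀ n P Q s t → hom n (P ⊖ Q) s t ≡ hom n P s t - hom n Q s t
hom-⊖ n P Q s t = begin
  hom n (P ⊕ negₚ Q) s t               ≡⟨ hom-⊕ n P (negₚ Q) s t ⟩
  hom n P s t + hom n (negₚ Q) s t     ≡⟨ cong (hom n P s t +_) (hom-scale n (- 1ℚ) Q s t) ⟩
  hom n P s t + - 1ℚ * hom n Q s t     ≡⟨ x+-1*y≡x-y (hom n P s t) (hom n Q s t) ⟩
  hom n P s t - hom n Q s t            ∎
  where
  x+-1*y≡x-y : ∀ x y → x + - 1ℚ * y ≡ x - y
  x+-1*y≡x-y = solve-∀ ℚ-ring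

hom-const : ∀ n a s t → hom n (const a) s t ≡ a * t ^ n
hom-const zero    a s t = sym (trans (cong (a *_) (^-zero t)) (ℚ.*-identityʳ a))
hom-const (suc n) a s t = trans (cong (a * t ^ suc n +_) (ℚ.*-zeroʳ s)) (ℚ.+-identityʳ _)

hom-0∷ : ∀ n P s t → hom (suc n) (0ℚ ∷ P) s t ≡ s * hom n P s t
hom-0∷ n P s t = 0*x+y≡y (t ^ suc n) (s * hom n P s t)
  where
  0*x+y≡y : ∀ x y → 0ℚ * x + y ≡ y
  0*x+y≡y = solve-∀ ℚ-ring

hom-X⊗ : ∀ n P s t → hom (suc n) (Xₚ ⊗ P) s t ≡ s * hom n P s t
hom-X⊗ n P s t = trans (hom-cong (suc n) (Xₚ ⊗ P) (0ℚ ∷ P) s t (X⊗-≈ P)) (hom-0∷ n P s t)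

hom-raise : ∀ n P s t → Deg≤ n P → hom (suc n) P s t ≡ t * hom n P s t
hom-raise n       []      s t P≤ = sym (trans (cong (t *_) (hom-[] n s t)) (ℚ.*-zeroʳ t))
hom-raise zero    (a ∷ P) s t P≤ = begin
  a * t ^ 1 + s * hom zero P s t  ≡⟨ cong₂ (λ u v → a * u + s * v) (trans (^-suc t 0) (cong (t *_) (^-zero t)))
                                                                   (trans (hom-zero P s t) (P≤ 1 (s≤s z≤n))) ⟩
  a * (t * 1ℚ) + s * 0ℚ           ≡⟨ identity a t s ⟩
  t * a                           ∎
  where
  identity : ∀ a t s → a * (t * 1ℚ) + s * 0ℚ ≡ t * a
  identity = solve-∀ ℚ-ring
hom-raise (suc n) (a ∷ P) s t P≤ = begin
  a * t ^ suc (suc n) + s * hom (suc n) P s t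
    ≡⟨ cong₂ (λ u v → a * u + s * v) (^-suc t (suc n)) (hom-raise n P s t (Deg≤-drop1 n (a ∷ P) P≤)) ⟩
  a * (t * t ^ suc n) + s * (t * hom n P s t)
    ≡⟨ factor a t (t ^ suc n) s (hom n P s t) ⟩
  t * (a * t ^ suc n + s * hom n P s t) ∎
  where
  factor : ∀ a t p s x → a * (t * p) + s * (t * x) ≡ t * (a * p + s * x)
  factor = solve-∀ ℚ-ring

hom-1+X⊗ : ∀ n P s t → Deg≤ n P → hom (suc n) (1+X ⊗ P) s t ≡ (s + t) * hom n P s t
hom-1+X⊗ n P s t P≤ = begin
  hom (suc n) (1+X ⊗ P) s t                   ≡⟨ hom-cong (suc n) (1+X ⊗ P) (P ⊕ (0ℚ ∷ P)) s t (1+X⊗-≈ P) ⟩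
  hom (suc n) (P ⊕ (0ℚ ∷ P)) s t              ≡⟨ hom-⊕ (suc n) P (0ℚ ∷ P) s t ⟩
  hom (suc n) P s t + hom (suc n) (0ℚ ∷ P) s t ≡⟨ cong₂ _+_ (hom-raise n P s t P≤) (hom-0∷ n P s t) ⟩
  t * hom n P s t + s * hom n P s t           ≡⟨ collect s t (hom n P s t) ⟩
  (s + t) * hom n P s t                       ∎
  where
  collect : ∀ s t x → t * x + s * x ≡ (s + t) * x
  collect = solve-∀ ℚ-ring

hom-∘1+X : ∀ n F s t → Deg≤ n F → hom n (F ∘ₚ 1+X) s t ≡ hom n F (s + t) t
hom-∘1+X n       []      s t F≤ = trans (hom-[] n s t) (sym (hom-[] n (s + t) t))
hom-∘1+X zero    (a ∷ F) s t F≤ = begin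
  hom zero (const a ⊕ (1+X ⊗ G)) s t  ≡⟨ hom-zero (const a ⊕ (1+X ⊗ G)) s t ⟩
  coeff (const a ⊕ (1+X ⊗ G)) 0       ≡⟨ coeff-⊕ (const a) (1+X ⊗ G) 0 ⟩
  a + coeff (1+X ⊗ G) 0          ≡⟨ cong (a +_) (1+X⊗-null G (∘1+X-null F (Deg≤0⇒drop1-null (a ∷ F) F≤)) 0) ⟩
  a + 0ℚ                         ≡⟨ ℚ.+-identityʳ a ⟩
  a                              ∎
  where G = F ∘ₚ 1+X
hom-∘1+X (suc n) (a ∷ F) s t F≤ = begin
  hom (suc n) (const a ⊕ (1+X ⊗ G)) s t
    ≡⟨ hom-⊕ (suc n) (const a) (1+X ⊗ G) s t ⟩
  hom (suc n) (const a) s t + hom (suc n) (1+X ⊗ G) s t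
    ≡⟨ cong₂ _+_ (hom-const (suc n) a s t) (hom-1+X⊗ n G s t (Deg≤-∘1+X n F F′≤)) ⟩
  a * t ^ suc n + (s + t) * hom n G s t
    ≡⟨ cong (λ z → a * t ^ suc n + (s + t) * z) (hom-∘1+X n F s t F′≤) ⟩
  a * t ^ suc n + (s + t) * hom n F (s + t) t ∎
  where
  G = F ∘ₚ 1+X
  F′≤ = Deg≤-drop1 n (a ∷ F) F≤

hom-Xpow : ∀ j n P s t → hom (j ℕ.+ n) (Xpow j P) s t ≡ s ^ j * hom n P s t
hom-Xpow zero    n P s t = sym (trans (cong (_* hom n P s t) (^-zero s)) (ℚ.*-identityˡ _))
hom-Xpow (suc j) n P s t = begin
  hom (suc (j ℕ.+ n)) (0ℚ ∷ Xpow j P) s t  ≡⟨ hom-0∷ (j ℕ.+ n) (Xpow j P) s t ⟩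
  s * hom (j ℕ.+ n) (Xpow j P) s t        ≡⟨ cong (s *_) (hom-Xpow j n P s t) ⟩
  s * (s ^ j * hom n P s t)               ≡⟨ sym (ℚ.*-assoc s (s ^ j) _) ⟩
  s * s ^ j * hom n P s t                 ≡⟨ cong (_* hom n P s t) (sym (^-suc s j)) ⟩
  s ^ suc j * hom n P s t                 ∎

hom-powₚ-1+X : ∀ k s t → hom k (powₚ 1+X k) s t ≡ (s + t) ^ k
hom-powₚ-1+X zero    s t = sym (^-zero (s + t))
hom-powₚ-1+X (suc k) s t = begin
  hom (suc k) (1+X ⊗ powₚ 1+X k) s t  ≡⟨ hom-1+X⊗ k (powₚ 1+X k) s t (Deg≤-powₚ-1+X k) ⟩
  (s + t) * hom k (powₚ 1+X k) s t    ≡⟨ cong ((s + t) *_) (hom-powₚ-1+X k s t) ⟩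
  (s + t) * (s + t) ^ k               ≡⟨ sym (^-suc (s + t) k) ⟩
  (s + t) ^ suc k                     ∎

hom-recipShiftFrom : ∀ j k F s t → Deg≤ j F →
  hom (j ℕ.+ k) (recipShiftFrom (j ℕ.+ k) k F) s t ≡ (s + t) ^ k * hom j F (s + t) s
hom-recipShiftFrom j       k []      s t F≤ =
  trans (hom-[] (j ℕ.+ k) s t) (sym (trans (cong ((s + t) ^ k *_) (hom-[] j (s + t) s)) (ℚ.*-zeroʳ ((s + t) ^ k))))
hom-recipShiftFrom zero    k (a ∷ F) s t F≤ = begin
  hom k (scale a (Xpow (k ∸ k) P) ⊕ R) s t
    ≡⟨ hom-⊕ k (scale a (Xpow (k ∸ k) P)) R s t ⟩
  hom k (scale a (Xpow (k ∸ k) P)) s t + hom k R s t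
    ≡⟨ cong₂ _+_ (hom-scale k a (Xpow (k ∸ k) P) s t)
                 (hom-null k R s t (recipShiftFrom-null k (suc k) F (Deg≤0⇒drop1-null (a ∷ F) F≤))) ⟩
  a * hom k (Xpow (k ∸ k) P) s t + 0ℚ
    ≡⟨ cong (λ z → a * hom k (Xpow z P) s t + 0ℚ) (ℕ.n∸n≡0 k) ⟩
  a * hom k P s t + 0ℚ
    ≡⟨ cong (λ z → a * z + 0ℚ) (hom-powₚ-1+X k s t) ⟩
  a * (s + t) ^ k + 0ℚ
    ≡⟨ commute a ((s + t) ^ k) ⟩
  (s + t) ^ k * a ∎
  where
  P = powₚ 1+X k
  R = recipShiftFrom k (suc k) F
  commute : ∀ a p → a * p + 0ℚ ≡ p * a
  commute = solve-∀ ℚ-ring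
hom-recipShiftFrom (suc j) k (a ∷ F) s t F≤ = begin
  hom m (scale a (Xpow (m ∸ k) P) ⊕ R) s t
    ≡⟨ hom-⊕ m (scale a (Xpow (m ∸ k) P)) R s t ⟩
  hom m (scale a (Xpow (m ∸ k) P)) s t + hom m R s t
    ≡⟨ cong (_+ hom m R s t) (hom-scale m a (Xpow (m ∸ k) P) s t) ⟩
  a * hom m (Xpow (m ∸ k) P) s t + hom m R s t
    ≡⟨ cong (λ z → a * hom m (Xpow z P) s t + hom m R s t) (ℕ.m+n∸n≡m (suc j) k) ⟩
  a * hom m (Xpow (suc j) P) s t + hom m R s t
    ≡⟨ cong₂ (λ u v → a * u + v) (hom-Xpow (suc j) k P s t) hom-R ⟩
  a * (s ^ suc j * hom k P s t) + (s + t) ^ suc k * hom j F (s + t) s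
    ≡⟨ cong₂ (λ u v → a * (s ^ suc j * u) + v * hom j F (s + t) s)
             (hom-powₚ-1+X k s t) (^-suc (s + t) k) ⟩
  a * (s ^ suc j * (s + t) ^ k) + (s + t) * (s + t) ^ k * hom j F (s + t) s
    ≡⟨ factor a (s + t) (s ^ suc j) ((s + t) ^ k) (hom j F (s + t) s) ⟩
  (s + t) ^ k * (a * s ^ suc j + (s + t) * hom j F (s + t) s) ∎
  where
  m = suc j ℕ.+ k
  P = powₚ 1+X k
  R = recipShiftFrom m (suc k) F
  hom-R : hom m R s t ≡ (s + t) ^ suc k * hom j F (s + t) s
  hom-R = subst (λ z → hom z (recipShiftFrom z (suc k) F) s t ≡ (s + t) ^ suc k * hom j F (s + t) s)
                (ℕ.+-suc j k) (hom-recipShiftFrom j (suc k) F s t (Deg≤-drop1 j (a ∷ F) F≤))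
  factor : ∀ a σ p q h → a * (p * q) + σ * q * h ≡ q * (a * p + σ * h)
  factor = solve-∀ ℚ-ring

hom-recipShift : ∀ m F s t → Deg≤ m F → hom m (recipShift m F) s t ≡ hom m F (s + t) s
hom-recipShift m F s t F≤ = begin
  hom m (recipShiftFrom m 0 F) s t        ≡⟨ subst (λ z → hom z (recipShiftFrom z 0 F) s t ≡ rhs)
                                                   (ℕ.+-identityʳ m) (hom-recipShiftFrom m 0 F s t F≤) ⟩
  rhs                                     ≡⟨ cong (_* hom m F (s + t) s) (^-zero (s + t)) ⟩
  1ℚ * hom m F (s + t) s                  ≡⟨ ℚ.*-identityˡ _ ⟩
  hom m F (s + t) s                       ∎
  where rhs = (s + t) ^ 0 * hom m F (s + t) s

hom-recipFrom : ∀ j k F s t → Deg≤ j F →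
  hom (j ℕ.+ k) (recipFrom (j ℕ.+ k) k F) s t ≡ t ^ k * hom j F t s
hom-recipFrom j       k []      s t F≤ =
  trans (hom-[] (j ℕ.+ k) s t) (sym (trans (cong (t ^ k *_) (hom-[] j t s)) (ℚ.*-zeroʳ (t ^ k))))
hom-recipFrom zero    k (a ∷ F) s t F≤ = begin
  hom k (Xpow (k ∸ k) (const a) ⊕ R) s t
    ≡⟨ hom-⊕ k (Xpow (k ∸ k) (const a)) R s t ⟩
  hom k (Xpow (k ∸ k) (const a)) s t + hom k R s t
    ≡⟨ cong₂ _+_ (cong (λ z → hom k (Xpow z (const a)) s t) (ℕ.n∸n≡0 k))
                 (hom-null k R s t (recipFrom-null k (suc k) F (Deg≤0⇒drop1-null (a ∷ F) F≤))) ⟩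
  hom k (const a) s t + 0ℚ
    ≡⟨ cong (_+ 0ℚ) (hom-const k a s t) ⟩
  a * t ^ k + 0ℚ
    ≡⟨ commute a (t ^ k) ⟩
  t ^ k * a ∎
  where
  R = recipFrom k (suc k) F
  commute : ∀ a p → a * p + 0ℚ ≡ p * a
  commute = solve-∀ ℚ-ring
hom-recipFrom (suc j) k (a ∷ F) s t F≤ = begin
  hom m (Xpow (m ∸ k) (const a) ⊕ R) s t
    ≡⟨ hom-⊕ m (Xpow (m ∸ k) (const a)) R s t ⟩
  hom m (Xpow (m ∸ k) (const a)) s t + hom m R s t
    ≡⟨ cong (λ z → hom m (Xpow z (const a)) s t + hom m R s t) (ℕ.m+n∸n≡m (suc j) k) ⟩
  hom m (Xpow (suc j) (const a)) s t + hom m R s t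
    ≡⟨ cong₂ _+_ (hom-Xpow (suc j) k (const a) s t) hom-R ⟩
  s ^ suc j * hom k (const a) s t + t ^ suc k * hom j F t s
    ≡⟨ cong₂ (λ u v → s ^ suc j * u + v * hom j F t s) (hom-const k a s t) (^-suc t k) ⟩
  s ^ suc j * (a * t ^ k) + t * t ^ k * hom j F t s
    ≡⟨ factor a t (s ^ suc j) (t ^ k) (hom j F t s) ⟩
  t ^ k * (a * s ^ suc j + t * hom j F t s) ∎
  where
  m = suc j ℕ.+ k
  R = recipFrom m (suc k) F
  hom-R : hom m R s t ≡ t ^ suc k * hom j F t s
  hom-R = subst (λ z → hom z (recipFrom z (suc k) F) s t ≡ t ^ suc k * hom j F t s)
                (ℕ.+-suc j k) (hom-recipFrom j (suc k) F s t (Deg≤-drop1 j (a ∷ F) F≤))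
  factor : ∀ a t p q h → p * (a * q) + t * q * h ≡ q * (a * p + t * h)
  factor = solve-∀ ℚ-ring

hom-recip : ∀ m F s t → Deg≤ m F → hom m (recip m F) s t ≡ hom m F t s
hom-recip m F s t F≤ = begin
  hom m (recipFrom m 0 F) s t   ≡⟨ subst (λ z → hom z (recipFrom z 0 F) s t ≡ rhs)
                                         (ℕ.+-identityʳ m) (hom-recipFrom m 0 F s t F≤) ⟩
  rhs                           ≡⟨ cong (_* hom m F t s) (^-zero t) ⟩
  1ℚ * hom m F t s              ≡⟨ ℚ.*-identityˡ _ ⟩
  hom m F t s                   ∎
  where rhs = t ^ 0 * hom m F t s

-- The formal derivative

coeff-derivFrom : ∀ k P n → coeff (derivFrom k P) n ≡ fromℕ (k ℕ.+ n) * coeff P n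
coeff-derivFrom k []      n       = sym (ℚ.*-zeroʳ (fromℕ (k ℕ.+ n)))
coeff-derivFrom k (a ∷ P) zero    = cong (λ z → fromℕ z * a) (sym (ℕ.+-identityʳ k))
coeff-derivFrom k (a ∷ P) (suc n) =
  trans (coeff-derivFrom (suc k) P n) (cong (λ z → fromℕ z * coeff P n) (sym (ℕ.+-suc k n)))

coeff-deriv : ∀ P n → coeff (deriv P) n ≡ fromℕ (suc n) * coeff P (suc n)
coeff-deriv []      n = sym (ℚ.*-zeroʳ (fromℕ (suc n)))
coeff-deriv (a ∷ P) n = coeff-derivFrom 1 P n

deriv-cong : ∀ {P Q} → P ≈ₚ Q → deriv P ≈ₚ deriv Q
deriv-cong {P} {Q} P≈Q n =
  trans (coeff-deriv P n) (trans (cong (fromℕ (suc n) *_) (P≈Q (suc n))) (sym (coeff-deriv Q n)))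

deriv-null : ∀ P → P ≈ₚ [] → deriv P ≈ₚ []
deriv-null P P≈0 = deriv-cong {P} {[]} P≈0

deriv-⊕ : ∀ P Q → deriv (P ⊕ Q) ≈ₚ deriv P ⊕ deriv Q
deriv-⊕ P Q n = begin
  coeff (deriv (P ⊕ Q)) n                        ≡⟨ coeff-deriv (P ⊕ Q) n ⟩
  k * coeff (P ⊕ Q) (suc n)                      ≡⟨ cong (k *_) (coeff-⊕ P Q (suc n)) ⟩
  k * (coeff P (suc n) + coeff Q (suc n))        ≡⟨ ℚ.*-distribˡ-+ k (coeff P (suc n)) (coeff Q (suc n)) ⟩
  k * coeff P (suc n) + k * coeff Q (suc n)      ≡⟨ sym (cong₂ _+_ (coeff-deriv P n) (coeff-deriv Q n)) ⟩
  coeff (deriv P) n + coeff (deriv Q) n          ≡⟨ sym (coeff-⊕ (deriv P) (deriv Q) n) ⟩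
  coeff (deriv P ⊕ deriv Q) n                    ∎
  where k = fromℕ (suc n)

deriv-scale : ∀ c P → deriv (scale c P) ≈ₚ scale c (deriv P)
deriv-scale c P n = begin
  coeff (deriv (scale c P)) n      ≡⟨ coeff-deriv (scale c P) n ⟩
  k * coeff (scale c P) (suc n)    ≡⟨ cong (k *_) (coeff-scale c P (suc n)) ⟩
  k * (c * coeff P (suc n))        ≡⟨ exchange k c (coeff P (suc n)) ⟩
  c * (k * coeff P (suc n))        ≡⟨ cong (c *_) (sym (coeff-deriv P n)) ⟩
  c * coeff (deriv P) n            ≡⟨ sym (coeff-scale c (deriv P) n) ⟩
  coeff (scale c (deriv P)) n      ∎
  where
  k = fromℕ (suc n)
  exchange : ∀ x c a → x * (c * a) ≡ c * (x * a)
  exchange = solve-∀ ℚ-ring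

deriv-⊖ : ∀ P Q → deriv (P ⊖ Q) ≈ₚ deriv P ⊖ deriv Q
deriv-⊖ P Q = ≈ₚ-trans {deriv (P ⊖ Q)} {deriv P ⊕ deriv (negₚ Q)} {deriv P ⊖ deriv Q}
  (deriv-⊕ P (negₚ Q))
  (⊕-cong {deriv P} {deriv P} {deriv (negₚ Q)} {negₚ (deriv Q)} (λ _ → refl) (deriv-scale (- 1ℚ) Q))

deriv-∷ : ∀ a P → deriv (a ∷ P) ≈ₚ P ⊕ (0ℚ ∷ deriv P)
deriv-∷ a P zero = begin
  coeff (deriv (a ∷ P)) 0      ≡⟨ coeff-deriv (a ∷ P) 0 ⟩
  fromℕ 1 * coeff P 0          ≡⟨ ℚ.*-identityˡ (coeff P 0) ⟩
  coeff P 0                    ≡⟨ sym (ℚ.+-identityʳ (coeff P 0)) ⟩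
  coeff P 0 + 0ℚ               ≡⟨ sym (coeff-⊕ P (0ℚ ∷ deriv P) 0) ⟩
  coeff (P ⊕ (0ℚ ∷ deriv P)) 0 ∎
deriv-∷ a P (suc n) = begin
  coeff (deriv (a ∷ P)) (suc n)               ≡⟨ coeff-deriv (a ∷ P) (suc n) ⟩
  fromℕ (suc (suc n)) * p                     ≡⟨ cong (_* p) (fromℕ-suc (suc n)) ⟩
  (1ℚ + fromℕ (suc n)) * p                    ≡⟨ distrib (fromℕ (suc n)) p ⟩
  p + fromℕ (suc n) * p                       ≡⟨ cong (p +_) (sym (coeff-deriv P n)) ⟩
  p + coeff (deriv P) n                       ≡⟨ sym (coeff-⊕ P (0ℚ ∷ deriv P) (suc n)) ⟩
  coeff (P ⊕ (0ℚ ∷ deriv P)) (suc n)          ∎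
  where
  p = coeff P (suc n)
  distrib : ∀ x a → (1ℚ + x) * a ≡ a + x * a
  distrib = solve-∀ ℚ-ring

deriv-1+X⊗ : ∀ G → deriv (1+X ⊗ G) ≈ₚ G ⊕ (1+X ⊗ deriv G)
deriv-1+X⊗ G zero = begin
  coeff (deriv (1+X ⊗ G)) 0                  ≡⟨ coeff-deriv (1+X ⊗ G) 0 ⟩
  fromℕ 1 * coeff (1+X ⊗ G) 1                ≡⟨ cong (fromℕ 1 *_) (coeff-1+X⊗-suc G 0) ⟩
  fromℕ 1 * (coeff G 1 + coeff G 0)          ≡⟨ rearrange (coeff G 1) (coeff G 0) ⟩
  coeff G 0 + fromℕ 1 * coeff G 1
    ≡⟨ cong (coeff G 0 +_) (sym (trans (coeff-1+X⊗-zero (deriv G)) (coeff-deriv G 0))) ⟩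
  coeff G 0 + coeff (1+X ⊗ deriv G) 0        ≡⟨ sym (coeff-⊕ G (1+X ⊗ deriv G) 0) ⟩
  coeff (G ⊕ (1+X ⊗ deriv G)) 0              ∎
  where
  rearrange : ∀ a b → 1ℚ * (a + b) ≡ b + 1ℚ * a
  rearrange = solve-∀ ℚ-ring
deriv-1+X⊗ G (suc n) = begin
  coeff (deriv (1+X ⊗ G)) (suc n)                       ≡⟨ coeff-deriv (1+X ⊗ G) (suc n) ⟩
  fromℕ (suc (suc n)) * coeff (1+X ⊗ G) (suc (suc n))
    ≡⟨ cong₂ _*_ (fromℕ-suc (suc n)) (coeff-1+X⊗-suc G (suc n)) ⟩
  (1ℚ + k) * (g₂ + g₁)                                  ≡⟨ rearrange k g₂ g₁ ⟩
  g₁ + ((1ℚ + k) * g₂ + k * g₁)                         ≡⟨ cong (λ z → g₁ + (z * g₂ + k * g₁)) (sym (fromℕ-suc (suc n))) ⟩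
  g₁ + (fromℕ (suc (suc n)) * g₂ + k * g₁)
    ≡⟨ cong (g₁ +_) (sym (trans (coeff-1+X⊗-suc (deriv G) n)
                                (cong₂ _+_ (coeff-deriv G (suc n)) (coeff-deriv G n)))) ⟩
  g₁ + coeff (1+X ⊗ deriv G) (suc n)                    ≡⟨ sym (coeff-⊕ G (1+X ⊗ deriv G) (suc n)) ⟩
  coeff (G ⊕ (1+X ⊗ deriv G)) (suc n)                   ∎
  where
  k  = fromℕ (suc n)
  g₂ = coeff G (suc (suc n))
  g₁ = coeff G (suc n)
  rearrange : ∀ x a b → (1ℚ + x) * (a + b) ≡ b + ((1ℚ + x) * a + x * b)
  rearrange = solve-∀ ℚ-ring

Deg≤-deriv : ∀ n P → Deg≤ (suc n) P → Deg≤ n (deriv P)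
Deg≤-deriv n P P≤ k n<k = trans (coeff-deriv P k)
  (trans (cong (fromℕ (suc k) *_) (P≤ (suc k) (s≤s n<k))) (ℚ.*-zeroʳ (fromℕ (suc k))))

Deg≤0⇒deriv-null : ∀ P → Deg≤ 0 P → deriv P ≈ₚ []
Deg≤0⇒deriv-null P P≤ k = trans (coeff-deriv P k)
  (trans (cong (fromℕ (suc k) *_) (P≤ (suc k) (s≤s z≤n))) (ℚ.*-zeroʳ (fromℕ (suc k))))

hom-deriv-∷ : ∀ n a F s t → Deg≤ n F →
  hom n (deriv (a ∷ F)) s t ≡ hom n F s t + s * hom (n ∸ 1) (deriv F) s t
hom-deriv-∷ n a F s t F≤ = begin
  hom n (deriv (a ∷ F)) s t                  ≡⟨ hom-cong n (deriv (a ∷ F)) (F ⊕ (0ℚ ∷ deriv F)) s t (deriv-∷ a F) ⟩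
  hom n (F ⊕ (0ℚ ∷ deriv F)) s t             ≡⟨ hom-⊕ n F (0ℚ ∷ deriv F) s t ⟩
  hom n F s t + hom n (0ℚ ∷ deriv F) s t     ≡⟨ cong (hom n F s t +_) (hom-0∷deriv n F≤) ⟩
  hom n F s t + s * hom (n ∸ 1) (deriv F) s t ∎
  where
  hom-0∷deriv : ∀ n → Deg≤ n F → hom n (0ℚ ∷ deriv F) s t ≡ s * hom (n ∸ 1) (deriv F) s t
  hom-0∷deriv zero    F≤ = sym (trans (cong (s *_) (trans (hom-zero (deriv F) s t)
                                                         (Deg≤0⇒deriv-null F F≤ 0)))
                                       (ℚ.*-zeroʳ s))
  hom-0∷deriv (suc n) F≤ = hom-0∷ n (deriv F) s t

hom-deriv-∘1+X : ∀ n F s t → Deg≤ (suc n) F → hom n (deriv (F ∘ₚ 1+X)) s t ≡ hom n (deriv F) (s + t) t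
hom-deriv-∘1+X n []      s t F≤ = trans (hom-[] n s t) (sym (hom-[] n (s + t) t))
hom-deriv-∘1+X n (a ∷ F) s t F≤ = begin
  hom n (deriv (const a ⊕ (1+X ⊗ G))) s t
    ≡⟨ hom-cong n (deriv (const a ⊕ (1+X ⊗ G))) (G ⊕ (1+X ⊗ deriv G)) s t
         (≈ₚ-trans {deriv (const a ⊕ (1+X ⊗ G))} {deriv (1+X ⊗ G)} {G ⊕ (1+X ⊗ deriv G)}
                   (deriv-⊕ (const a) (1+X ⊗ G)) (deriv-1+X⊗ G)) ⟩
  hom n (G ⊕ (1+X ⊗ deriv G)) s t
    ≡⟨ hom-⊕ n G (1+X ⊗ deriv G) s t ⟩
  hom n G s t + hom n (1+X ⊗ deriv G) s t
    ≡⟨ cong₂ _+_ (hom-∘1+X n F s t F′≤) (hom-1+X⊗deriv n F′≤) ⟩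
  hom n F σ t + σ * hom (n ∸ 1) (deriv F) σ t
    ≡⟨ sym (hom-deriv-∷ n a F σ t F′≤) ⟩
  hom n (deriv (a ∷ F)) σ t ∎
  where
  G  = F ∘ₚ 1+X
  σ  = s + t
  F′≤ = Deg≤-drop1 n (a ∷ F) F≤
  hom-1+X⊗deriv : ∀ n → Deg≤ n F → hom n (1+X ⊗ deriv G) s t ≡ σ * hom (n ∸ 1) (deriv F) σ t
  hom-1+X⊗deriv zero    F≤ = begin
    hom zero (1+X ⊗ deriv G) s t    ≡⟨ hom-zero (1+X ⊗ deriv G) s t ⟩
    coeff (1+X ⊗ deriv G) 0         ≡⟨ coeff-1+X⊗-zero (deriv G) ⟩
    coeff (deriv G) 0               ≡⟨ Deg≤0⇒deriv-null G (Deg≤-∘1+X 0 F F≤) 0 ⟩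
    0ℚ                              ≡⟨ sym (ℚ.*-zeroʳ σ) ⟩
    σ * 0ℚ                          ≡⟨ cong (σ *_) (sym (trans (hom-zero (deriv F) σ t) (Deg≤0⇒deriv-null F F≤ 0))) ⟩
    σ * hom zero (deriv F) σ t      ∎
  hom-1+X⊗deriv (suc n) F≤ =
    trans (hom-1+X⊗ n (deriv G) s t (Deg≤-deriv n G (Deg≤-∘1+X (suc n) F F≤)))
          (cong (σ *_) (hom-deriv-∘1+X n F s t F≤))

powDeriv : ℕ → ℚ → ℚ
powDeriv zero    σ = 0ℚ
powDeriv (suc k) σ = fromℕ (suc k) * σ ^ k

powDeriv*σ : ∀ k σ → powDeriv k σ * σ ≡ fromℕ k * σ ^ k
powDeriv*σ zero    σ = trans (ℚ.*-zeroˡ σ) (sym (ℚ.*-zeroˡ (σ ^ zero)))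
powDeriv*σ (suc k) σ = trans (reassoc (fromℕ (suc k)) (σ ^ k) σ) (cong (fromℕ (suc k) *_) (sym (^-suc σ k)))
  where
  reassoc : ∀ n p σ → n * p * σ ≡ n * (σ * p)
  reassoc = solve-∀ ℚ-ring

hom-deriv-powₚ-1+X : ∀ k s t → hom (k ∸ 1) (deriv (powₚ 1+X k)) s t ≡ powDeriv k (s + t)
hom-deriv-powₚ-1+X zero          s t = refl
hom-deriv-powₚ-1+X (suc zero)    s t = begin
  hom 0 (deriv (1+X ⊗ (1ℚ ∷ []))) s t
    ≡⟨ hom-cong 0 (deriv (1+X ⊗ (1ℚ ∷ []))) ((1ℚ ∷ []) ⊕ (1+X ⊗ [])) s t (deriv-1+X⊗ (1ℚ ∷ [])) ⟩
  hom 0 ((1ℚ ∷ []) ⊕ (1+X ⊗ [])) s t  ≡⟨ hom-zero ((1ℚ ∷ []) ⊕ (1+X ⊗ [])) s t ⟩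
  coeff ((1ℚ ∷ []) ⊕ (1+X ⊗ [])) 0    ≡⟨ coeff-⊕ (1ℚ ∷ []) (1+X ⊗ []) 0 ⟩
  1ℚ + coeff (1+X ⊗ []) 0             ≡⟨ cong (1ℚ +_) (coeff-1+X⊗-zero []) ⟩
  fromℕ 1 * 1ℚ                        ≡⟨ cong (fromℕ 1 *_) (sym (^-zero (s + t))) ⟩
  fromℕ 1 * (s + t) ^ 0               ∎
hom-deriv-powₚ-1+X (suc (suc k)) s t = begin
  hom (suc k) (deriv (1+X ⊗ P)) s t
    ≡⟨ hom-cong (suc k) (deriv (1+X ⊗ P)) (P ⊕ (1+X ⊗ deriv P)) s t (deriv-1+X⊗ P) ⟩
  hom (suc k) (P ⊕ (1+X ⊗ deriv P)) s t
    ≡⟨ hom-⊕ (suc k) P (1+X ⊗ deriv P) s t ⟩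
  hom (suc k) P s t + hom (suc k) (1+X ⊗ deriv P) s t
    ≡⟨ cong₂ _+_ (hom-powₚ-1+X (suc k) s t) (hom-1+X⊗ k (deriv P) s t (Deg≤-deriv k P (Deg≤-powₚ-1+X (suc k)))) ⟩
  σ ^ suc k + σ * hom k (deriv P) s t
    ≡⟨ cong (λ z → σ ^ suc k + σ * z) (hom-deriv-powₚ-1+X (suc k) s t) ⟩
  σ ^ suc k + σ * (fromℕ (suc k) * σ ^ k)
    ≡⟨ cong (_+ σ * (fromℕ (suc k) * σ ^ k)) (^-suc σ k) ⟩
  σ * σ ^ k + σ * (fromℕ (suc k) * σ ^ k)
    ≡⟨ collect σ (σ ^ k) (fromℕ (suc k)) ⟩
  (1ℚ + fromℕ (suc k)) * (σ * σ ^ k)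
    ≡⟨ cong₂ _*_ (sym (fromℕ-suc (suc k))) (sym (^-suc σ k)) ⟩
  fromℕ (suc (suc k)) * σ ^ suc k ∎
  where
  σ = s + t
  P = powₚ 1+X (suc k)
  collect : ∀ σ p n → σ * p + σ * (n * p) ≡ (1ℚ + n) * (σ * p)
  collect = solve-∀ ℚ-ring

hom-deriv-Xpow : ∀ j k P s t → Deg≤ k P →
  s * hom (j ℕ.+ k ∸ 1) (deriv (Xpow j P)) s t ≡
  fromℕ j * s ^ j * hom k P s t + s ^ j * (s * hom (k ∸ 1) (deriv P) s t)
hom-deriv-Xpow zero    k P s t P≤ = begin
  D                                        ≡⟨ identity D (hom k P s t) ⟩
  0ℚ * 1ℚ * hom k P s t + 1ℚ * D           ≡⟨ cong (λ p → 0ℚ * p * hom k P s t + p * D) (sym (^-zero s)) ⟩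
  0ℚ * s ^ 0 * hom k P s t + s ^ 0 * D     ∎
  where
  D = s * hom (k ∸ 1) (deriv P) s t
  identity : ∀ d h → d ≡ 0ℚ * 1ℚ * h + 1ℚ * d
  identity = solve-∀ ℚ-ring
hom-deriv-Xpow (suc j) k P s t P≤ = begin
  s * hom (j ℕ.+ k) (deriv (0ℚ ∷ X)) s t
    ≡⟨ cong (s *_) (hom-deriv-∷ (j ℕ.+ k) 0ℚ X s t (Deg≤-Xpow j k P P≤)) ⟩
  s * (hom (j ℕ.+ k) X s t + s * hom (j ℕ.+ k ∸ 1) (deriv X) s t)
    ≡⟨ cong₂ (λ u v → s * (u + v)) (hom-Xpow j k P s t) (hom-deriv-Xpow j k P s t P≤) ⟩
  s * (s ^ j * hom k P s t + (fromℕ j * s ^ j * hom k P s t + s ^ j * D))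
    ≡⟨ collect s (s ^ j) (hom k P s t) (fromℕ j) D ⟩
  (1ℚ + fromℕ j) * (s * s ^ j) * hom k P s t + s * s ^ j * D
    ≡⟨ cong₂ (λ u v → u * v * hom k P s t + v * D) (sym (fromℕ-suc j)) (sym (^-suc s j)) ⟩
  fromℕ (suc j) * s ^ suc j * hom k P s t + s ^ suc j * D ∎
  where
  X = Xpow j P
  D = s * hom (k ∸ 1) (deriv P) s t
  collect : ∀ s p h n d → s * (p * h + (n * p * h + p * d)) ≡ (1ℚ + n) * (s * p) * h + s * p * d
  collect = solve-∀ ℚ-ring

hom-deriv-Xpow-powₚ-1+X : ∀ j k s t →
  s * hom (j ℕ.+ k ∸ 1) (deriv (Xpow j (powₚ 1+X k))) s t ≡
  fromℕ j * s ^ j * (s + t) ^ k + s ^ j * (s * powDeriv k (s + t))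
hom-deriv-Xpow-powₚ-1+X j k s t = trans (hom-deriv-Xpow j k (powₚ 1+X k) s t (Deg≤-powₚ-1+X k))
  (cong₂ (λ u v → fromℕ j * s ^ j * u + s ^ j * (s * v)) (hom-powₚ-1+X k s t) (hom-deriv-powₚ-1+X k s t))

deriv-scale-⊕ : ∀ a T R → deriv (scale a T ⊕ R) ≈ₚ scale a (deriv T) ⊕ deriv R
deriv-scale-⊕ a T R =
  ≈ₚ-trans {deriv (scale a T ⊕ R)} {deriv (scale a T) ⊕ deriv R} {scale a (deriv T) ⊕ deriv R}
    (deriv-⊕ (scale a T) R)
    (⊕-cong {deriv (scale a T)} {scale a (deriv T)} {deriv R} {deriv R} (deriv-scale a T) (λ _ → refl))

recipShiftFrom-derivative-step : ∀ a s t j k h h′ → let σ = s + t in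
  a * (fromℕ (suc j) * s ^ suc j * σ ^ k + s ^ suc j * (s * powDeriv k σ)) +
  (fromℕ (suc k) * σ ^ k * s * h + σ ^ suc k * (fromℕ j * h - t * h′)) ≡
  powDeriv k σ * s * (a * s ^ suc j + σ * h) + σ ^ k * (fromℕ (suc j) * (a * s ^ suc j + σ * h) - t * (h + σ * h′))
recipShiftFrom-derivative-step a s t j k h h′ = begin
  a * ((fromℕ (suc j)) * Sʲ * Σᵏ + Sʲ * (s * K)) + (fromℕ (suc k) * Σᵏ * s * h + σ ^ suc k * (fromℕ j * h - t * h′))
    ≡⟨ cong₃ (fromℕ-suc j) (fromℕ-suc k) (^-suc σ k) ⟩
  a * ((1ℚ + fromℕ j) * Sʲ * Σᵏ + Sʲ * (s * K)) + ((1ℚ + fromℕ k) * Σᵏ * s * h + σ * Σᵏ * (fromℕ j * h - t * h′))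
    ≡⟨ regroup a s t K Sʲ Σᵏ (fromℕ j) (fromℕ k) h h′ ⟩
  B + (fromℕ k * Σᵏ - K * σ) * (s * h)
    ≡⟨ cong (λ z → B + (fromℕ k * Σᵏ - z) * (s * h)) (powDeriv*σ k σ) ⟩
  B + (fromℕ k * Σᵏ - fromℕ k * Σᵏ) * (s * h)
    ≡⟨ cancel B (fromℕ k * Σᵏ) (s * h) ⟩
  B
    ≡⟨ cong (λ u → K * s * (a * Sʲ + σ * h) + Σᵏ * (u * (a * Sʲ + σ * h) - t * (h + σ * h′))) (sym (fromℕ-suc j)) ⟩
  K * s * (a * Sʲ + σ * h) + Σᵏ * (fromℕ (suc j) * (a * Sʲ + σ * h) - t * (h + σ * h′)) ∎
  where
  σ  = s + t
  K  = powDeriv k σ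
  Sʲ = s ^ suc j
  Σᵏ = σ ^ k
  B  = K * s * (a * Sʲ + σ * h) + Σᵏ * ((1ℚ + fromℕ j) * (a * Sʲ + σ * h) - t * (h + σ * h′))
  cong₃ : ∀ {x x′ y y′ z z′} → x ≡ x′ → y ≡ y′ → z ≡ z′ →
          a * (x * Sʲ * Σᵏ + Sʲ * (s * K)) + (y * Σᵏ * s * h + z * (fromℕ j * h - t * h′)) ≡
          a * (x′ * Sʲ * Σᵏ + Sʲ * (s * K)) + (y′ * Σᵏ * s * h + z′ * (fromℕ j * h - t * h′))
  cong₃ refl refl refl = refl
  cancel : ∀ A x y → A + (x - x) * y ≡ A
  cancel = solve-∀ ℚ-ring
  regroup : ∀ a s t K Sʲ Σᵏ nj nk h h′ →
    a * ((1ℚ + nj) * Sʲ * Σᵏ + Sʲ * (s * K)) + ((1ℚ + nk) * Σᵏ * s * h + (s + t) * Σᵏ * (nj * h - t * h′)) ≡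
    K * s * (a * Sʲ + (s + t) * h) + Σᵏ * ((1ℚ + nj) * (a * Sʲ + (s + t) * h) - t * (h + (s + t) * h′))
      + (nk * Σᵏ - K * (s + t)) * (s * h)
  regroup = solve-∀ ℚ-ring

hom-deriv-recipShiftFrom : ∀ j k F s t → Deg≤ j F →
  s * hom (j ℕ.+ k ∸ 1) (deriv (recipShiftFrom (j ℕ.+ k) k F)) s t ≡
  powDeriv k (s + t) * s * hom j F (s + t) s +
  (s + t) ^ k * (fromℕ j * hom j F (s + t) s - t * hom (j ∸ 1) (deriv F) (s + t) s)
hom-deriv-recipShiftFrom j k [] s t F≤ = begin
  s * hom (j ℕ.+ k ∸ 1) [] s t
    ≡⟨ cong (s *_) (hom-[] (j ℕ.+ k ∸ 1) s t) ⟩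
  s * 0ℚ
    ≡⟨ identity s (powDeriv k (s + t)) ((s + t) ^ k) (fromℕ j) t ⟩
  powDeriv k (s + t) * s * 0ℚ + (s + t) ^ k * (fromℕ j * 0ℚ - t * 0ℚ)
    ≡⟨ sym (cong₂ (λ u v → powDeriv k (s + t) * s * u + (s + t) ^ k * (fromℕ j * u - t * v))
                  (hom-[] j (s + t) s) (hom-[] (j ∸ 1) (s + t) s)) ⟩
  powDeriv k (s + t) * s * hom j [] (s + t) s +
  (s + t) ^ k * (fromℕ j * hom j [] (s + t) s - t * hom (j ∸ 1) [] (s + t) s) ∎
  where
  identity : ∀ s K p n t → s * 0ℚ ≡ K * s * 0ℚ + p * (n * 0ℚ - t * 0ℚ)
  identity = solve-∀ ℚ-ring
hom-deriv-recipShiftFrom zero k (a ∷ F) s t F≤ = begin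
  s * hom (k ∸ 1) (deriv (scale a T ⊕ R)) s t
    ≡⟨ cong (s *_) (hom-cong (k ∸ 1) (deriv (scale a T ⊕ R)) (scale a (deriv T) ⊕ deriv R) s t (deriv-scale-⊕ a T R)) ⟩
  s * hom (k ∸ 1) (scale a (deriv T) ⊕ deriv R) s t
    ≡⟨ cong (s *_) (trans (hom-⊕ (k ∸ 1) (scale a (deriv T)) (deriv R) s t)
         (cong₂ _+_ (hom-scale (k ∸ 1) a (deriv T) s t) (hom-null (k ∸ 1) (deriv R) s t (deriv-null R R≈0)))) ⟩
  s * (a * hom (k ∸ 1) (deriv T) s t + 0ℚ)
    ≡⟨ cong (λ z → s * (a * hom (k ∸ 1) (deriv (Xpow z P)) s t + 0ℚ)) (ℕ.n∸n≡0 k) ⟩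
  s * (a * hom (k ∸ 1) (deriv P) s t + 0ℚ)
    ≡⟨ cong (λ z → s * (a * z + 0ℚ)) (hom-deriv-powₚ-1+X k s t) ⟩
  s * (a * powDeriv k σ + 0ℚ)
    ≡⟨ identity s a (powDeriv k σ) (σ ^ k) t ⟩
  powDeriv k σ * s * a + σ ^ k * (0ℚ * a - t * 0ℚ)
    ≡⟨ sym (cong₂ (λ u v → powDeriv k σ * s * u + σ ^ k * (0ℚ * u - t * v))
                  (hom-zero (a ∷ F) σ s) (trans (hom-zero (deriv (a ∷ F)) σ s) (Deg≤0⇒deriv-null (a ∷ F) F≤ 0))) ⟩
  powDeriv k σ * s * hom zero (a ∷ F) σ s +
    σ ^ k * (fromℕ zero * hom zero (a ∷ F) σ s - t * hom zero (deriv (a ∷ F)) σ s) ∎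
  where
  σ = s + t
  P = powₚ 1+X k
  T = Xpow (k ∸ k) P
  R = recipShiftFrom k (suc k) F
  R≈0 = recipShiftFrom-null k (suc k) F (Deg≤0⇒drop1-null (a ∷ F) F≤)
  identity : ∀ s a K p t → s * (a * K + 0ℚ) ≡ K * s * a + p * (0ℚ * a - t * 0ℚ)
  identity = solve-∀ ℚ-ring
hom-deriv-recipShiftFrom (suc j) k (a ∷ F) s t F≤ = begin
  s * hom (j ℕ.+ k) (deriv (scale a T ⊕ R)) s t
    ≡⟨ cong (s *_) (hom-cong (j ℕ.+ k) (deriv (scale a T ⊕ R)) (scale a (deriv T) ⊕ deriv R) s t
                              (deriv-scale-⊕ a T R)) ⟩
  s * hom (j ℕ.+ k) (scale a (deriv T) ⊕ deriv R) s t
    ≡⟨ cong (s *_) (trans (hom-⊕ (j ℕ.+ k) (scale a (deriv T)) (deriv R) s t)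
                          (cong (_+ hom (j ℕ.+ k) (deriv R) s t) (hom-scale (j ℕ.+ k) a (deriv T) s t))) ⟩
  s * (a * hom (j ℕ.+ k) (deriv T) s t + hom (j ℕ.+ k) (deriv R) s t)
    ≡⟨ distribute s a (hom (j ℕ.+ k) (deriv T) s t) (hom (j ℕ.+ k) (deriv R) s t) ⟩
  a * (s * hom (j ℕ.+ k) (deriv T) s t) + s * hom (j ℕ.+ k) (deriv R) s t
    ≡⟨ cong₂ (λ u v → a * u + v) hom-deriv-T hom-deriv-R ⟩
  a * (fromℕ (suc j) * s ^ suc j * σ ^ k + s ^ suc j * (s * powDeriv k σ)) +
    (fromℕ (suc k) * σ ^ k * s * h + σ ^ suc k * (fromℕ j * h - t * h′))
    ≡⟨ recipShiftFrom-derivative-step a s t j k h h′ ⟩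
  powDeriv k σ * s * (a * s ^ suc j + σ * h) + σ ^ k * (fromℕ (suc j) * (a * s ^ suc j + σ * h) - t * (h + σ * h′))
    ≡⟨ cong (λ v → powDeriv k σ * s * (a * s ^ suc j + σ * h) + σ ^ k * (fromℕ (suc j) * (a * s ^ suc j + σ * h) - t * v))
            (sym (hom-deriv-∷ j a F σ s F′≤)) ⟩
  powDeriv k σ * s * hom (suc j) (a ∷ F) σ s +
    σ ^ k * (fromℕ (suc j) * hom (suc j) (a ∷ F) σ s - t * hom j (deriv (a ∷ F)) σ s) ∎
  where
  σ  = s + t
  m  = suc j ℕ.+ k
  P  = powₚ 1+X k
  T  = Xpow (m ∸ k) P
  R  = recipShiftFrom m (suc k) F
  h  = hom j F σ s
  h′ = hom (j ∸ 1) (deriv F) σ s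
  F′≤ = Deg≤-drop1 j (a ∷ F) F≤
  hom-deriv-T : s * hom (j ℕ.+ k) (deriv T) s t ≡ fromℕ (suc j) * s ^ suc j * σ ^ k + s ^ suc j * (s * powDeriv k σ)
  hom-deriv-T = trans (cong (λ z → s * hom (j ℕ.+ k) (deriv (Xpow z P)) s t) (ℕ.m+n∸n≡m (suc j) k))
                      (hom-deriv-Xpow-powₚ-1+X (suc j) k s t)
  hom-deriv-R : s * hom (j ℕ.+ k) (deriv R) s t ≡
                fromℕ (suc k) * σ ^ k * s * h + σ ^ suc k * (fromℕ j * h - t * h′)
  hom-deriv-R = subst (λ z → s * hom (z ∸ 1) (deriv (recipShiftFrom z (suc k) F)) s t ≡
                             fromℕ (suc k) * σ ^ k * s * h + σ ^ suc k * (fromℕ j * h - t * h′))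
                      (ℕ.+-suc j k) (hom-deriv-recipShiftFrom j (suc k) F s t F′≤)
  distribute : ∀ s a x y → s * (a * x + y) ≡ a * (s * x) + s * y
  distribute = solve-∀ ℚ-ring

hom-deriv-recipShift : ∀ m F s t → Deg≤ m F →
  s * hom (m ∸ 1) (deriv (recipShift m F)) s t ≡
  fromℕ m * hom m F (s + t) s - t * hom (m ∸ 1) (deriv F) (s + t) s
hom-deriv-recipShift m F s t F≤ = begin
  s * hom (m ∸ 1) (deriv (recipShiftFrom m 0 F)) s t
    ≡⟨ subst (λ z → s * hom (z ∸ 1) (deriv (recipShiftFrom z 0 F)) s t ≡ powDeriv 0 σ * s * h + σ ^ 0 * A)
             (ℕ.+-identityʳ m) (hom-deriv-recipShiftFrom m 0 F s t F≤) ⟩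
  0ℚ * s * h + σ ^ 0 * A     ≡⟨ cong (λ p → 0ℚ * s * h + p * A) (^-zero σ) ⟩
  0ℚ * s * h + 1ℚ * A        ≡⟨ identity s h A ⟩
  A                          ∎
  where
  σ = s + t
  h = hom m F σ s
  A = fromℕ m * h - t * hom (m ∸ 1) (deriv F) σ s
  identity : ∀ s h A → 0ℚ * s * h + 1ℚ * A ≡ A
  identity = solve-∀ ℚ-ring

-- Parity

EvenPoly : Poly → Set
EvenPoly P = ∀ k → coeff P (suc (2 ℕ.* k)) ≡ 0ℚ

2*suc : ∀ k → 2 ℕ.* suc k ≡ suc (suc (2 ℕ.* k))
2*suc k = ℕ.*-suc 2 k

EvenPoly-drop1 : ∀ P → EvenPoly P → OddPoly (drop 1 P)
EvenPoly-drop1 P P-even k = trans (coeff-drop1 P (2 ℕ.* k)) (P-even k)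

OddPoly-drop1 : ∀ P → OddPoly P → EvenPoly (drop 1 P)
OddPoly-drop1 P P-odd k =
  trans (coeff-drop1 P (suc (2 ℕ.* k))) (trans (cong (coeff P) (sym (2*suc k))) (P-odd (suc k)))

OddPoly-deriv : ∀ P → EvenPoly P → OddPoly (deriv P)
OddPoly-deriv P P-even k = trans (coeff-deriv P (2 ℕ.* k))
  (trans (cong (fromℕ (suc (2 ℕ.* k)) *_) (P-even k)) (ℚ.*-zeroʳ (fromℕ (suc (2 ℕ.* k)))))

EvenPoly-deriv : ∀ P → OddPoly P → EvenPoly (deriv P)
EvenPoly-deriv P P-odd k = trans (coeff-deriv P (suc (2 ℕ.* k)))
  (trans (cong (fromℕ (suc (suc (2 ℕ.* k))) *_) (trans (cong (coeff P) (sym (2*suc k))) (P-odd (suc k))))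
         (ℚ.*-zeroʳ (fromℕ (suc (suc (2 ℕ.* k))))))

hom-even : ∀ n P s t → EvenPoly P → hom n P (- s) t ≡ hom n P s t
hom-odd  : ∀ n P s t → OddPoly P → hom n P (- s) t ≡ - hom n P s t

hom-even zero    P s t P-even = trans (hom-zero P (- s) t) (sym (hom-zero P s t))
hom-even (suc n) P s t P-even = begin
  hom (suc n) P (- s) t                                     ≡⟨ hom-suc n P (- s) t ⟩
  coeff P 0 * t ^ suc n + - s * hom n (drop 1 P) (- s) t
    ≡⟨ cong (λ z → coeff P 0 * t ^ suc n + - s * z) (hom-odd n (drop 1 P) s t (EvenPoly-drop1 P P-even)) ⟩
  coeff P 0 * t ^ suc n + - s * - hom n (drop 1 P) s t      ≡⟨ cong (coeff P 0 * t ^ suc n +_) (neg*neg s _) ⟩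
  coeff P 0 * t ^ suc n + s * hom n (drop 1 P) s t          ≡⟨ sym (hom-suc n P s t) ⟩
  hom (suc n) P s t                                         ∎
  where
  neg*neg : ∀ x y → - x * - y ≡ x * y
  neg*neg = solve-∀ ℚ-ring

hom-odd zero    P s t P-odd = begin
  hom zero P (- s) t  ≡⟨ trans (hom-zero P (- s) t) (P-odd 0) ⟩
  0ℚ                  ≡⟨ sym (cong -_ (trans (hom-zero P s t) (P-odd 0))) ⟩
  - hom zero P s t    ∎
hom-odd (suc n) P s t P-odd = begin
  hom (suc n) P (- s) t                                   ≡⟨ hom-suc n P (- s) t ⟩
  coeff P 0 * t ^ suc n + - s * hom n (drop 1 P) (- s) t
    ≡⟨ cong₂ (λ u v → u * t ^ suc n + - s * v) (P-odd 0) (hom-even n (drop 1 P) s t (OddPoly-drop1 P P-odd)) ⟩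
  0ℚ * t ^ suc n + - s * hom n (drop 1 P) s t             ≡⟨ negate (t ^ suc n) s _ ⟩
  - (0ℚ * t ^ suc n + s * hom n (drop 1 P) s t)
    ≡⟨ cong (λ z → - (z * t ^ suc n + s * hom n (drop 1 P) s t)) (sym (P-odd 0)) ⟩
  - (coeff P 0 * t ^ suc n + s * hom n (drop 1 P) s t)    ≡⟨ cong -_ (sym (hom-suc n P s t)) ⟩
  - hom (suc n) P s t                                     ∎
  where
  negate : ∀ p s h → 0ℚ * p + - s * h ≡ - (0ℚ * p + s * h)
  negate = solve-∀ ℚ-ring

-[1]^-even : ∀ k → (- 1ℚ) ^ (2 ℕ.* k) ≡ 1ℚ
-[1]^-even zero    = ^-zero (- 1ℚ)
-[1]^-even (suc k) = begin
  (- 1ℚ) ^ (2 ℕ.* suc k)                   ≡⟨ cong ((- 1ℚ) ^_) (2*suc k) ⟩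
  (- 1ℚ) ^ suc (suc (2 ℕ.* k))             ≡⟨ trans (^-suc (- 1ℚ) _) (cong (- 1ℚ *_) (^-suc (- 1ℚ) _)) ⟩
  - 1ℚ * (- 1ℚ * (- 1ℚ) ^ (2 ℕ.* k))       ≡⟨ cong (λ z → - 1ℚ * (- 1ℚ * z)) (-[1]^-even k) ⟩
  - 1ℚ * (- 1ℚ * 1ℚ)                       ≡⟨⟩
  1ℚ                                       ∎

-[1]^-odd : ∀ k → (- 1ℚ) ^ suc (2 ℕ.* k) ≡ - 1ℚ
-[1]^-odd k = trans (^-suc (- 1ℚ) (2 ℕ.* k)) (trans (cong (- 1ℚ *_) (-[1]^-even k)) refl)

[-t]^n : ∀ t n → (- t) ^ n ≡ (- 1ℚ) ^ n * t ^ n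
[-t]^n t zero    = trans (^-zero (- t)) (sym (trans (cong₂ _*_ (^-zero (- 1ℚ)) (^-zero t)) refl))
[-t]^n t (suc n) = begin
  (- t) ^ suc n                          ≡⟨ ^-suc (- t) n ⟩
  - t * (- t) ^ n                        ≡⟨ cong (- t *_) ([-t]^n t n) ⟩
  - t * ((- 1ℚ) ^ n * t ^ n)             ≡⟨ rearrange t ((- 1ℚ) ^ n) (t ^ n) ⟩
  - 1ℚ * (- 1ℚ) ^ n * (t * t ^ n)        ≡⟨ sym (cong₂ _*_ (^-suc (- 1ℚ) n) (^-suc t n)) ⟩
  (- 1ℚ) ^ suc n * t ^ suc n             ∎
  where
  rearrange : ∀ t g p → - t * (g * p) ≡ - 1ℚ * g * (t * p)
  rearrange = solve-∀ ℚ-ring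

hom-neg-neg : ∀ n P s t → hom n P (- s) (- t) ≡ (- 1ℚ) ^ n * hom n P s t
hom-neg-neg zero    P s t = begin
  hom zero P (- s) (- t)           ≡⟨ hom-zero P (- s) (- t) ⟩
  coeff P 0                        ≡⟨ sym (ℚ.*-identityˡ (coeff P 0)) ⟩
  1ℚ * coeff P 0                   ≡⟨ cong₂ _*_ (sym (^-zero (- 1ℚ))) (sym (hom-zero P s t)) ⟩
  (- 1ℚ) ^ zero * hom zero P s t   ∎
hom-neg-neg (suc n) P s t = begin
  hom (suc n) P (- s) (- t)                                       ≡⟨ hom-suc n P (- s) (- t) ⟩
  coeff P 0 * (- t) ^ suc n + - s * hom n (drop 1 P) (- s) (- t)
    ≡⟨ cong₂ (λ u v → coeff P 0 * u + - s * v) ([-t]^n t (suc n)) (hom-neg-neg n (drop 1 P) s t) ⟩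
  coeff P 0 * ((- 1ℚ) ^ suc n * t ^ suc n) + - s * ((- 1ℚ) ^ n * hom n (drop 1 P) s t)
    ≡⟨ cong (λ z → coeff P 0 * (z * t ^ suc n) + - s * ((- 1ℚ) ^ n * hom n (drop 1 P) s t)) (^-suc (- 1ℚ) n) ⟩
  coeff P 0 * (- 1ℚ * (- 1ℚ) ^ n * t ^ suc n) + - s * ((- 1ℚ) ^ n * hom n (drop 1 P) s t)
    ≡⟨ factor (coeff P 0) ((- 1ℚ) ^ n) (t ^ suc n) s (hom n (drop 1 P) s t) ⟩
  - 1ℚ * (- 1ℚ) ^ n * (coeff P 0 * t ^ suc n + s * hom n (drop 1 P) s t)
    ≡⟨ cong₂ _*_ (sym (^-suc (- 1ℚ) n)) (sym (hom-suc n P s t)) ⟩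
  (- 1ℚ) ^ suc n * hom (suc n) P s t                              ∎
  where
  factor : ∀ a g p s h → a * (- 1ℚ * g * p) + - s * (g * h) ≡ - 1ℚ * g * (a * p + s * h)
  factor = solve-∀ ℚ-ring

reflect : Poly → Poly
reflect []      = []
reflect (a ∷ P) = a ∷ negₚ (reflect P)

coeff-reflect : ∀ P n → coeff (reflect P) n ≡ (- 1ℚ) ^ n * coeff P n
coeff-reflect []      n       = sym (ℚ.*-zeroʳ ((- 1ℚ) ^ n))
coeff-reflect (a ∷ P) zero    = sym (trans (cong (_* a) (^-zero (- 1ℚ))) (ℚ.*-identityˡ a))
coeff-reflect (a ∷ P) (suc n) = begin
  coeff (negₚ (reflect P)) n        ≡⟨ coeff-negₚ (reflect P) n ⟩
  - coeff (reflect P) n             ≡⟨ cong -_ (coeff-reflect P n) ⟩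
  - ((- 1ℚ) ^ n * coeff P n)        ≡⟨ negate ((- 1ℚ) ^ n) (coeff P n) ⟩
  - 1ℚ * (- 1ℚ) ^ n * coeff P n     ≡⟨ cong (_* coeff P n) (sym (^-suc (- 1ℚ) n)) ⟩
  (- 1ℚ) ^ suc n * coeff P n        ∎
  where
  negate : ∀ g x → - (g * x) ≡ - 1ℚ * g * x
  negate = solve-∀ ℚ-ring

hom-reflect : ∀ n P s t → hom n (reflect P) s t ≡ hom n P (- s) t
hom-reflect n       []      s t = trans (hom-[] n s t) (sym (hom-[] n (- s) t))
hom-reflect zero    (a ∷ P) s t = refl
hom-reflect (suc n) (a ∷ P) s t = cong (a * t ^ suc n +_) (begin
  s * hom n (negₚ (reflect P)) s t   ≡⟨ cong (s *_) (hom-scale n (- 1ℚ) (reflect P) s t) ⟩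
  s * (- 1ℚ * hom n (reflect P) s t) ≡⟨ cong (λ z → s * (- 1ℚ * z)) (hom-reflect n P s t) ⟩
  s * (- 1ℚ * hom n P (- s) t)       ≡⟨ move s (hom n P (- s) t) ⟩
  - s * hom n P (- s) t              ∎)
  where
  move : ∀ s h → s * (- 1ℚ * h) ≡ - s * h
  move = solve-∀ ℚ-ring

Deg≤-reflect : ∀ n P → Deg≤ n P → Deg≤ n (reflect P)
Deg≤-reflect n P P≤ k n<k =
  trans (coeff-reflect P k) (trans (cong ((- 1ℚ) ^ k *_) (P≤ k n<k)) (ℚ.*-zeroʳ ((- 1ℚ) ^ k)))

-- Evaluation, and polynomials vanishing at all large integers

eval : Poly → ℚ → ℚ
eval []      y = 0ℚ
eval (a ∷ P) y = a + y * eval P y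

eval-null : ∀ P y → P ≈ₚ [] → eval P y ≡ 0ℚ
eval-null []      y P≈0 = refl
eval-null (a ∷ P) y P≈0 =
  trans (cong₂ (λ u v → u + y * v) (P≈0 0) (eval-null P y (λ k → P≈0 (suc k)))) (0+y*0≡0 y)
  where
  0+y*0≡0 : ∀ y → 0ℚ + y * 0ℚ ≡ 0ℚ
  0+y*0≡0 = solve-∀ ℚ-ring

hom-eval : ∀ n P y → Deg≤ n P → hom n P y 1ℚ ≡ eval P y
hom-eval n       []      y P≤ = hom-[] n y 1ℚ
hom-eval zero    (a ∷ P) y P≤ = sym (begin
  a + y * eval P y     ≡⟨ cong (λ z → a + y * z) (eval-null P y (Deg≤0⇒drop1-null (a ∷ P) P≤)) ⟩
  a + y * 0ℚ           ≡⟨ a+y*0≡a a y ⟩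
  a                    ∎)
  where
  a+y*0≡a : ∀ a y → a + y * 0ℚ ≡ a
  a+y*0≡a = solve-∀ ℚ-ring
hom-eval (suc n) (a ∷ P) y P≤ =
  cong₂ (λ u v → u + y * v) (trans (cong (a *_) (1^n≡1 (suc n))) (ℚ.*-identityʳ a))
                            (hom-eval n P y (Deg≤-drop1 n (a ∷ P) P≤))

quotient : ℚ → Poly → Poly
quotient c []          = []
quotient c (a ∷ [])    = []
quotient c (a ∷ b ∷ P) = eval (b ∷ P) c ∷ quotient c (b ∷ P)

eval-quotient : ∀ c P y → eval P y ≡ (y - c) * eval (quotient c P) y + eval P c
eval-quotient c []          y = identity y c
  where
  identity : ∀ y c → 0ℚ ≡ (y - c) * 0ℚ + 0ℚ
  identity = solve-∀ ℚ-ring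
eval-quotient c (a ∷ [])    y = identity a y c
  where
  identity : ∀ a y c → a + y * 0ℚ ≡ (y - c) * 0ℚ + (a + c * 0ℚ)
  identity = solve-∀ ℚ-ring
eval-quotient c (a ∷ b ∷ P) y = begin
  a + y * eval (b ∷ P) y                    ≡⟨ cong (λ z → a + y * z) (eval-quotient c (b ∷ P) y) ⟩
  a + y * ((y - c) * q + e)                 ≡⟨ identity a y c q e ⟩
  (y - c) * (e + y * q) + (a + c * e)       ∎
  where
  q = eval (quotient c (b ∷ P)) y
  e = eval (b ∷ P) c
  identity : ∀ a y c q e → a + y * ((y - c) * q + e) ≡ (y - c) * (e + y * q) + (a + c * e)
  identity = solve-∀ ℚ-ring

quotient-null : ∀ c P → quotient c P ≈ₚ [] → eval P c ≡ 0ℚ → P ≈ₚ []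
quotient-null c []          Q≈0 Pc≡0 k       = refl
quotient-null c (a ∷ [])    Q≈0 Pc≡0 zero    = trans (sym (a+c*0≡a a c)) Pc≡0
  where
  a+c*0≡a : ∀ a c → a + c * 0ℚ ≡ a
  a+c*0≡a = solve-∀ ℚ-ring
quotient-null c (a ∷ [])    Q≈0 Pc≡0 (suc k) = refl
quotient-null c (a ∷ b ∷ P) Q≈0 Pc≡0 zero    =
  trans (sym (trans (cong (λ z → a + c * z) (Q≈0 0)) (a+c*0≡a a c))) Pc≡0
  where
  a+c*0≡a : ∀ a c → a + c * 0ℚ ≡ a
  a+c*0≡a = solve-∀ ℚ-ring
quotient-null c (a ∷ b ∷ P) Q≈0 Pc≡0 (suc k) = quotient-null c (b ∷ P) (λ j → Q≈0 (suc j)) (Q≈0 0) k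

length-quotient : ∀ c a P → length (quotient c (a ∷ P)) ≡ length P
length-quotient c a []      = refl
length-quotient c a (b ∷ P) = cong suc (length-quotient c b P)

roots-from⇒null : ∀ n P r → length P ≤ n → (∀ i → eval P (fromℕ (r ℕ.+ i)) ≡ 0ℚ) → P ≈ₚ []
roots-from⇒null n       []          r _         roots k = refl
roots-from⇒null (suc n) (a ∷ [])    r _         roots zero =
  trans (sym (a+y*0≡a a (fromℕ r))) (trans (cong (λ z → eval (a ∷ []) (fromℕ z)) (sym (ℕ.+-identityʳ r))) (roots 0))
  where
  a+y*0≡a : ∀ a y → a + y * 0ℚ ≡ a
  a+y*0≡a = solve-∀ ℚ-ring
roots-from⇒null (suc n) (a ∷ [])    r _         roots (suc k) = refl
roots-from⇒null (suc n) (a ∷ b ∷ P) r (s≤s |P|≤n) roots = quotient-null c (a ∷ b ∷ P) Q≈0 root-c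
  where
  c = fromℕ r
  root-c : eval (a ∷ b ∷ P) c ≡ 0ℚ
  root-c = trans (cong (λ z → eval (a ∷ b ∷ P) (fromℕ z)) (sym (ℕ.+-identityʳ r))) (roots 0)
  Q = quotient c (a ∷ b ∷ P)
  shift : ∀ i → fromℕ (suc r ℕ.+ i) - c ≡ fromℕ (suc i)
  shift i = begin
    fromℕ (suc r ℕ.+ i) - c         ≡⟨ cong (λ z → fromℕ z - c) (sym (ℕ.+-suc r i)) ⟩
    fromℕ (r ℕ.+ suc i) - c         ≡⟨ cong (_- c) (fromℕ-+ r (suc i)) ⟩
    c + fromℕ (suc i) - c           ≡⟨ x+y-x≡y c (fromℕ (suc i)) ⟩
    fromℕ (suc i)                   ∎
    where
    x+y-x≡y : ∀ x y → x + y - x ≡ y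
    x+y-x≡y = solve-∀ ℚ-ring
  Q-roots : ∀ i → eval Q (fromℕ (suc r ℕ.+ i)) ≡ 0ℚ
  Q-roots i = p*q≡0⇒q≡0 (y - c) (eval Q y) (λ eq → fromℕ-suc≢0 i (trans (sym (shift i)) eq)) (begin
    (y - c) * eval Q y                        ≡⟨ sym (ℚ.+-identityʳ _) ⟩
    (y - c) * eval Q y + 0ℚ                   ≡⟨ cong ((y - c) * eval Q y +_) (sym root-c) ⟩
    (y - c) * eval Q y + eval (a ∷ b ∷ P) c   ≡⟨ sym (eval-quotient c (a ∷ b ∷ P) y) ⟩
    eval (a ∷ b ∷ P) y
      ≡⟨ subst (λ z → eval (a ∷ b ∷ P) (fromℕ z) ≡ 0ℚ) (ℕ.+-suc r i) (roots (suc i)) ⟩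
    0ℚ                                        ∎)
    where y = fromℕ (suc r ℕ.+ i)
  Q≈0 : Q ≈ₚ []
  Q≈0 = roots-from⇒null n Q (suc r) (subst (_≤ n) (sym (length-quotient c a (b ∷ P))) |P|≤n) Q-roots

lincomb≡0 : ∀ (c₁ c₂ c₃ c₄ c₅ c₆ c₇ c₈ c₉ : ℚ) {r₁ r₂ r₃ r₄ r₅ r₆ r₇ r₈ r₉ : ℚ} →
  r₁ ≡ 0ℚ → r₂ ≡ 0ℚ → r₃ ≡ 0ℚ → r₄ ≡ 0ℚ → r₅ ≡ 0ℚ → r₆ ≡ 0ℚ → r₇ ≡ 0ℚ → r₈ ≡ 0ℚ → r₉ ≡ 0ℚ →
  c₁ * r₁ + c₂ * r₂ + c₃ * r₃ + c₄ * r₄ + c₅ * r₅ + c₆ * r₆ + c₇ * r₇ + c₈ * r₈ + c₉ * r₉ ≡ 0ℚ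
lincomb≡0 c₁ c₂ c₃ c₄ c₅ c₆ c₇ c₈ c₉ refl refl refl refl refl refl refl refl refl =
  identity c₁ c₂ c₃ c₄ c₅ c₆ c₇ c₈ c₉
  where
  identity : ∀ c₁ c₂ c₃ c₄ c₅ c₆ c₇ c₈ c₉ →
    c₁ * 0ℚ + c₂ * 0ℚ + c₃ * 0ℚ + c₄ * 0ℚ + c₅ * 0ℚ + c₆ * 0ℚ + c₇ * 0ℚ + c₈ * 0ℚ + c₉ * 0ℚ ≡ 0ℚ
  identity = solve-∀ ℚ-ring

x≡y⇒x-y≡0 : ∀ {x y} → x ≡ y → x - y ≡ 0ℚ
x≡y⇒x-y≡0 {x} refl = x-x≡0 x
  where
  x-x≡0 : ∀ x → x - x ≡ 0ℚ
  x-x≡0 = solve-∀ ℚ-ring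

two*[x-y]≡0⇒x≡y : ∀ x y → two * (x - y) ≡ 0ℚ → x ≡ y
two*[x-y]≡0⇒x≡y x y eq = begin
  x                ≡⟨ split x y ⟩
  (x - y) + y      ≡⟨ cong (_+ y) (p*q≡0⇒q≡0 two (x - y) (λ ()) eq) ⟩
  0ℚ + y           ≡⟨ ℚ.+-identityˡ y ⟩
  y                ∎
  where
  split : ∀ x y → x ≡ (x - y) + y
  split = solve-∀ ℚ-ring

-- The bracketed terms on the right are, in order, the relations for h at
-- x, x+1, x-1, those for d at (x,1), (x+1,1), (x-1,1), and their reflected
-- forms at (1,x), (1,x+1), (1,x-1) (see Combination below).
nine-relation-identity : ∀ (x M a d[1,x] d[1,x-1] d[1,x+1] d[x,1] d[x,x-1] d[x,x+1] d[x-1,1] d[x-1,x]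
  d[x-2,1] d[x-2,x-1] d[x+1,1] d[x+1,x] d[x+2,1] d[x+2,x+1] h[x,1] h[x,x-1] h[x,x+1] h[x-1,1] h[x-1,x]
  h[x-2,1] h[x-2,x-1] h[x+1,1] h[x+1,x] h[x+2,1] h[x+2,x+1] : ℚ) →
  two * (two * (x * (d[x,1] + d[1,x])) - (x + 1ℚ) * (d[x+1,1] + d[1,x+1]) - (x + 1ℚ) * (d[x+1,x] + d[x,x+1])
         - (x - 1ℚ) * (d[x-1,1] + d[1,x-1]) + (x - 1ℚ) * (d[x-1,x] + d[x,x-1]) - two * (two * a * M)) ≡
  two * M * ((two * h[x,1] - h[x+1,1] - h[x+1,x] - h[x-1,1] + h[x-1,x]) - two * a) +
  M * (x + 1ℚ) * ((two * h[x+1,1] - h[x+2,1] - h[x+2,x+1] - h[x,1] + h[x,x+1]) - two * a) +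
  - (M * (x - 1ℚ)) * ((two * h[x-1,1] - h[x,1] - h[x,x-1] - h[x-2,1] + h[x-2,x-1]) - two * a) +
  - two * (two * x * d[x,1] - x * d[x+1,1] - x * d[x-1,1] - M * h[x+1,x] + M * h[x-1,x]
           + 1ℚ * d[x+1,x] + 1ℚ * d[x-1,x]) +
  - (x + 1ℚ) * (two * (x + 1ℚ) * d[x+1,1] - (x + 1ℚ) * d[x+2,1] - (x + 1ℚ) * d[x,1] - M * h[x+2,x+1]
                + M * h[x,x+1] + 1ℚ * d[x+2,x+1] + 1ℚ * d[x,x+1]) +
  (x - 1ℚ) * (two * (x - 1ℚ) * d[x-1,1] - (x - 1ℚ) * d[x,1] - (x - 1ℚ) * d[x-2,1] - M * h[x,x-1]
              + M * h[x-2,x-1] + 1ℚ * d[x,x-1] + 1ℚ * d[x-2,x-1]) +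
  two * x * (two * 1ℚ * d[1,x] - 1ℚ * d[x+1,x] + 1ℚ * d[x-1,x] - M * h[x+1,1] + M * h[x-1,1]
             + x * d[x+1,1] - x * d[x-1,1]) +
  - (x + 1ℚ) * (two * 1ℚ * d[1,x+1] - 1ℚ * d[x+2,x+1] + 1ℚ * d[x,x+1] - M * h[x+2,1] + M * h[x,1]
                + (x + 1ℚ) * d[x+2,1] - (x + 1ℚ) * d[x,1]) +
  - (x - 1ℚ) * (two * 1ℚ * d[1,x-1] - 1ℚ * d[x,x-1] + 1ℚ * d[x-2,x-1] - M * h[x,1] + M * h[x-2,1]
                + (x - 1ℚ) * d[x,1] - (x - 1ℚ) * d[x-2,1])
nine-relation-identity = solve-∀ ℚ-ring

homXp : (ℚ → ℚ → ℚ) → ℚ → ℚ → ℚ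
homXp d σ τ = σ * (d σ τ + d τ σ)

-- h and d play the parts of the homogenisations of C and C′: h-relation
-- says that L_C is a constant plus an odd polynomial, d-relation that its
-- derivative is even.
module Combination
  (h d : ℚ → ℚ → ℚ) (M a : ℚ)
  (h-even : ∀ s t → h (- s) t ≡ h s t)
  (d-odd  : ∀ s t → d (- s) t ≡ - d s t)
  (h-relation : ∀ s u v → u ≡ s + 1ℚ → v ≡ s - 1ℚ →
                two * h s 1ℚ - h u 1ℚ - h u s - h v 1ℚ + h v s ≡ two * a)
  (d-relation : ∀ s t u v → u ≡ s + t → v ≡ s - t →
                two * s * d s t - s * d u t - s * d v t - M * h u s + M * h v s + t * d u s + t * d v s ≡ 0ℚ)
  where

  d-relation′ : ∀ s t u w → u ≡ s + t → w ≡ t - s →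
    two * s * d s t - s * d u t + s * d w t - M * h u s + M * h w s + t * d u s - t * d w s ≡ 0ℚ
  d-relation′ s t u w u≡s+t w≡t-s = begin
    two * s * d s t - s * d u t + s * d w t - M * h u s + M * h w s + t * d u s - t * d w s
      ≡⟨ push-signs s t (d s t) (d u t) (d w t) M (h u s) (h w s) (d u s) (d w s) ⟩
    two * s * d s t - s * d u t - s * - d w t - M * h u s + M * h w s + t * d u s + t * - d w s
      ≡⟨ cong₃ (sym (d-odd w t)) (sym (h-even w s)) (sym (d-odd w s)) ⟩
    two * s * d s t - s * d u t - s * d (- w) t - M * h u s + M * h (- w) s + t * d u s + t * d (- w) s
      ≡⟨ d-relation s t u (- w) u≡s+t (trans (cong -_ w≡t-s) (-[t-s]≡s-t t s)) ⟩
    0ℚ ∎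
    where
    push-signs : ∀ s t a b c M e f g i →
      two * s * a - s * b + s * c - M * e + M * f + t * g - t * i ≡
      two * s * a - s * b - s * - c - M * e + M * f + t * g + t * - i
    push-signs = solve-∀ ℚ-ring
    -[t-s]≡s-t : ∀ t s → - (t - s) ≡ s - t
    -[t-s]≡s-t = solve-∀ ℚ-ring
    cong₃ : ∀ {x x′ y y′ z z′} → x ≡ x′ → y ≡ y′ → z ≡ z′ →
      two * s * d s t - s * d u t - s * x - M * h u s + M * y + t * d u s + t * z ≡
      two * s * d s t - s * d u t - s * x′ - M * h u s + M * y′ + t * d u s + t * z′
    cong₃ refl refl refl = refl

  G-relation : ∀ x → let G = homXp d in
    two * G x 1ℚ - G (x + 1ℚ) 1ℚ - G (x + 1ℚ) x - G (x - 1ℚ) 1ℚ + G (x - 1ℚ) x ≡ two * (two * a * M)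
  G-relation x = two*[x-y]≡0⇒x≡y _ _ (trans
    (nine-relation-identity x M a (d 1ℚ x) (d 1ℚ x-1) (d 1ℚ x+1) (d x 1ℚ) (d x x-1) (d x x+1)
       (d x-1 1ℚ) (d x-1 x) (d x-2 1ℚ) (d x-2 x-1) (d x+1 1ℚ) (d x+1 x) (d x+2 1ℚ) (d x+2 x+1)
       (h x 1ℚ) (h x x-1) (h x x+1) (h x-1 1ℚ) (h x-1 x) (h x-2 1ℚ) (h x-2 x-1)
       (h x+1 1ℚ) (h x+1 x) (h x+2 1ℚ) (h x+2 x+1))
    (lincomb≡0 (two * M) (M * x+1) (- (M * x-1)) (- two) (- x+1) x-1 (two * x) (- x+1) (- x-1)
       (x≡y⇒x-y≡0 (h-relation x   x+1 x-1 refl refl))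
       (x≡y⇒x-y≡0 (h-relation x+1 x+2 x   refl (x≡x+1-1 x)))
       (x≡y⇒x-y≡0 (h-relation x-1 x   x-2 (x≡x-1+1 x) refl))
       (d-relation  x   1ℚ x+1 x-1 refl refl)
       (d-relation  x+1 1ℚ x+2 x   refl (x≡x+1-1 x))
       (d-relation  x-1 1ℚ x   x-2 (x≡x-1+1 x) refl)
       (d-relation′ 1ℚ x   x+1 x-1 (ℚ.+-comm x 1ℚ) refl)
       (d-relation′ 1ℚ x+1 x+2 x   (ℚ.+-comm x+1 1ℚ) (x≡x+1-1 x))
       (d-relation′ 1ℚ x-1 x   x-2 (x≡1+[x-1] x) refl)))
    where
    x+1 = x + 1ℚ
    x-1 = x - 1ℚ
    x+2 = x + 1ℚ + 1ℚ
    x-2 = x - 1ℚ - 1ℚ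
    x≡x+1-1 : ∀ x → x ≡ x + 1ℚ - 1ℚ
    x≡x+1-1 = solve-∀ ℚ-ring
    x≡x-1+1 : ∀ x → x ≡ x - 1ℚ + 1ℚ
    x≡x-1+1 = solve-∀ ℚ-ring
    x≡1+[x-1] : ∀ x → x ≡ 1ℚ + (x - 1ℚ)
    x≡1+[x-1] = solve-∀ ℚ-ring

Deg≤-L : ∀ m F → Deg≤ m F → Deg≤ m (L (2 ℕ.+ m) F)
Deg≤-L m F F≤ = Deg≤-⊖ m (F ⊖ (F ∘ₚ 1+X)) (recipShift m F)
  (Deg≤-⊖ m F (F ∘ₚ 1+X) F≤ (Deg≤-∘1+X m F F≤)) (Deg≤-recipShiftFrom m 0 F F≤)

hom-L : ∀ m F s t → Deg≤ m F →
  hom m (L (2 ℕ.+ m) F) s t ≡ hom m F s t - hom m F (s + t) t - hom m F (s + t) s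
hom-L m F s t F≤ = begin
  hom m (F ⊖ (F ∘ₚ 1+X) ⊖ recipShift m F) s t
    ≡⟨ hom-⊖ m (F ⊖ (F ∘ₚ 1+X)) (recipShift m F) s t ⟩
  hom m (F ⊖ (F ∘ₚ 1+X)) s t - hom m (recipShift m F) s t
    ≡⟨ cong₂ _-_ (hom-⊖ m F (F ∘ₚ 1+X) s t) (hom-recipShift m F s t F≤) ⟩
  hom m F s t - hom m (F ∘ₚ 1+X) s t - hom m F (s + t) s
    ≡⟨ cong (λ z → hom m F s t - z - hom m F (s + t) s) (hom-∘1+X m F s t F≤) ⟩
  hom m F s t - hom m F (s + t) t - hom m F (s + t) s ∎

hom-deriv-L : ∀ n F s t → Deg≤ (suc n) F →
  s * hom n (deriv (L (3 ℕ.+ n) F)) s t ≡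
  s * hom n (deriv F) s t - s * hom n (deriv F) (s + t) t -
  (fromℕ (suc n) * hom (suc n) F (s + t) s - t * hom n (deriv F) (s + t) s)
hom-deriv-L n F s t F≤ = begin
  s * hom n (deriv (F ⊖ G ⊖ R)) s t
    ≡⟨ cong (s *_) (hom-cong n (deriv (F ⊖ G ⊖ R)) (deriv F ⊖ deriv G ⊖ deriv R) s t deriv-L) ⟩
  s * hom n (deriv F ⊖ deriv G ⊖ deriv R) s t
    ≡⟨ cong (s *_) (trans (hom-⊖ n (deriv F ⊖ deriv G) (deriv R) s t)
                          (cong (_- hom n (deriv R) s t) (hom-⊖ n (deriv F) (deriv G) s t))) ⟩
  s * (hom n (deriv F) s t - hom n (deriv G) s t - hom n (deriv R) s t)
    ≡⟨ cong (λ z → s * (hom n (deriv F) s t - z - hom n (deriv R) s t)) (hom-deriv-∘1+X n F s t F≤) ⟩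
  s * (hom n (deriv F) s t - hom n (deriv F) (s + t) t - hom n (deriv R) s t)
    ≡⟨ distribute s (hom n (deriv F) s t) (hom n (deriv F) (s + t) t) (hom n (deriv R) s t) ⟩
  s * hom n (deriv F) s t - s * hom n (deriv F) (s + t) t - s * hom n (deriv R) s t
    ≡⟨ cong (λ z → s * hom n (deriv F) s t - s * hom n (deriv F) (s + t) t - z)
            (hom-deriv-recipShift (suc n) F s t F≤) ⟩
  s * hom n (deriv F) s t - s * hom n (deriv F) (s + t) t -
  (fromℕ (suc n) * hom (suc n) F (s + t) s - t * hom n (deriv F) (s + t) s) ∎
  where
  G = F ∘ₚ 1+X
  R = recipShift (suc n) F
  deriv-L : deriv (F ⊖ G ⊖ R) ≈ₚ deriv F ⊖ deriv G ⊖ deriv R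
  deriv-L = ≈ₚ-trans {deriv (F ⊖ G ⊖ R)} {deriv (F ⊖ G) ⊖ deriv R} {deriv F ⊖ deriv G ⊖ deriv R}
    (deriv-⊖ (F ⊖ G) R)
    (⊖-cong {deriv (F ⊖ G)} {deriv F ⊖ deriv G} {deriv R} {deriv R} (deriv-⊖ F G) (λ _ → refl))
  distribute : ∀ s a b c → s * (a - b - c) ≡ s * a - s * b - s * c
  distribute = solve-∀ ℚ-ring

hom-L-symmetrised : ∀ m F s t u v → Deg≤ m F →
  (∀ s t → hom m F (- s) t ≡ hom m F s t) → (∀ s t → hom m F s (- t) ≡ - hom m F s t) →
  u ≡ s + t → v ≡ s - t →
  hom m (L (2 ℕ.+ m) F) s t + hom m (L (2 ℕ.+ m) F) (- s) t ≡
  two * hom m F s t - hom m F u t - hom m F u s - hom m F v t + hom m F v s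
hom-L-symmetrised m F s t u v F≤ f-even f-odd refl refl = begin
  hom m (L (2 ℕ.+ m) F) s t + hom m (L (2 ℕ.+ m) F) (- s) t
    ≡⟨ cong₂ _+_ (hom-L m F s t F≤) (hom-L m F (- s) t F≤) ⟩
  (f s t - f u t - f u s) + (f (- s) t - f (- s + t) t - f (- s + t) (- s))
    ≡⟨ cong (λ z → (f s t - f u t - f u s) + (f (- s) t - f z t - f z (- s))) (-s+t≡-[s-t] s t) ⟩
  (f s t - f u t - f u s) + (f (- s) t - f (- v) t - f (- v) (- s))
    ≡⟨ cong₂ (λ x y → (f s t - f u t - f u s) + (x - f (- v) t - y)) (f-even s t) (trans (f-even v (- s)) (f-odd v s)) ⟩
  (f s t - f u t - f u s) + (f s t - f (- v) t - - f v s)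
    ≡⟨ cong (λ z → (f s t - f u t - f u s) + (f s t - z - - f v s)) (f-even v t) ⟩
  (f s t - f u t - f u s) + (f s t - f v t - - f v s)
    ≡⟨ collect (f s t) (f u t) (f u s) (f v t) (f v s) ⟩
  two * f s t - f u t - f u s - f v t + f v s ∎
  where
  f = hom m F
  -s+t≡-[s-t] : ∀ s t → - s + t ≡ - (s - t)
  -s+t≡-[s-t] = solve-∀ ℚ-ring
  collect : ∀ a b c e g → (a - b - c) + (a - e - - g) ≡ two * a - b - c - e + g
  collect = solve-∀ ℚ-ring

null-even-part⇒ConstPlusOdd : ∀ V c → (V ⊕ reflect V) ⊖ const c ≈ₚ [] → ConstPlusOdd V
null-even-part⇒ConstPlusOdd V c S≈0 = coeff V 0 , 0ℚ ∷ drop 1 V , odd , split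
  where
  even-coeff : ∀ k → coeff V (2 ℕ.* suc k) ≡ 0ℚ
  even-coeff k = p*q≡0⇒q≡0 two v (λ ()) (begin
    two * v                                     ≡⟨ double v ⟩
    v + 1ℚ * v - 0ℚ                             ≡⟨ cong (λ z → v + z * v - 0ℚ) (sym (-[1]^-even (suc k))) ⟩
    v + (- 1ℚ) ^ j * v - 0ℚ                     ≡⟨ cong (λ z → v + z - 0ℚ) (sym (coeff-reflect V j)) ⟩
    v + coeff (reflect V) j - 0ℚ                ≡⟨ cong (_- 0ℚ) (sym (coeff-⊕ V (reflect V) j)) ⟩
    coeff (V ⊕ reflect V) j - coeff (const c) j ≡⟨ sym (coeff-⊖ (V ⊕ reflect V) (const c) j) ⟩
    coeff ((V ⊕ reflect V) ⊖ const c) j         ≡⟨ S≈0 j ⟩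
    0ℚ                                          ∎)
    where
    j = 2 ℕ.* suc k
    v = coeff V j
    double : ∀ v → two * v ≡ v + 1ℚ * v - 0ℚ
    double = solve-∀ ℚ-ring
  odd : OddPoly (0ℚ ∷ drop 1 V)
  odd zero    = refl
  odd (suc k) = trans (cong (coeff (0ℚ ∷ drop 1 V)) (2*suc k))
    (trans (coeff-drop1 V (suc (2 ℕ.* k))) (trans (cong (coeff V) (sym (2*suc k))) (even-coeff k)))
  split : V ≈ₚ const (coeff V 0) ⊕ (0ℚ ∷ drop 1 V)
  split zero    = sym (ℚ.+-identityʳ (coeff V 0))
  split (suc n) = sym (coeff-drop1 V n)

ConstPlusOdd-from-symmetrisation : ∀ m V c → Deg≤ m V →
  (∀ i → hom m V (fromℕ i) 1ℚ + hom m V (- fromℕ i) 1ℚ ≡ c) → ConstPlusOdd V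
ConstPlusOdd-from-symmetrisation m V c V≤ sym-const =
  null-even-part⇒ConstPlusOdd V c (roots-from⇒null (length S) S 0 ℕ.≤-refl S-roots)
  where
  S = (V ⊕ reflect V) ⊖ const c
  S≤ : Deg≤ m S
  S≤ = Deg≤-⊖ m (V ⊕ reflect V) (const c) (Deg≤-⊕ m V (reflect V) V≤ (Deg≤-reflect m V V≤)) (Deg≤-const m c)
  S-roots : ∀ i → eval S (fromℕ (0 ℕ.+ i)) ≡ 0ℚ
  S-roots i = begin
    eval S x                                                ≡⟨ sym (hom-eval m S x S≤) ⟩
    hom m S x 1ℚ                                            ≡⟨ hom-⊖ m (V ⊕ reflect V) (const c) x 1ℚ ⟩
    hom m (V ⊕ reflect V) x 1ℚ - hom m (const c) x 1ℚ
      ≡⟨ cong₂ _-_ (hom-⊕ m V (reflect V) x 1ℚ) (hom-const m c x 1ℚ) ⟩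
    hom m V x 1ℚ + hom m (reflect V) x 1ℚ - c * 1ℚ ^ m
      ≡⟨ cong₂ (λ u w → hom m V x 1ℚ + u - c * w) (hom-reflect m V x 1ℚ) (1^n≡1 m) ⟩
    hom m V x 1ℚ + hom m V (- x) 1ℚ - c * 1ℚ               ≡⟨ cong (_- c * 1ℚ) (sym-const i) ⟩
    c - c * 1ℚ                                             ≡⟨ x-x*1≡0 c ⟩
    0ℚ                                                     ∎
    where
    x = fromℕ i
    x-x*1≡0 : ∀ x → x - x * 1ℚ ≡ 0ℚ
    x-x*1≡0 = solve-∀ ℚ-ring

-- The relations satisfied by the homogenisations of C and C′

module Homogenised (K : ℕ) (C : Poly) (C-even : EvenPoly C) (C≤ : Deg≤ (2 ℕ.* K) C) where

  n m : ℕ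
  n = 2 ℕ.* K
  m = suc n

  h d : ℚ → ℚ → ℚ
  h = hom m C
  d = hom n (deriv C)

  C≤m : Deg≤ m C
  C≤m = Deg≤-mono C (ℕ.n≤1+n n) C≤

  C′≤ : Deg≤ n (deriv C)
  C′≤ = Deg≤-deriv n C C≤m

  h-even : ∀ s t → h (- s) t ≡ h s t
  h-even s t = hom-even m C s t C-even

  d-odd : ∀ s t → d (- s) t ≡ - d s t
  d-odd s t = hom-odd n (deriv C) s t (OddPoly-deriv C C-even)

  h-odd₂ : ∀ s t → h s (- t) ≡ - h s t
  h-odd₂ s t = begin
    h s (- t)                ≡⟨ cong (λ z → h z (- t)) (neg-neg s) ⟩
    h (- (- s)) (- t)        ≡⟨ hom-neg-neg m C (- s) t ⟩
    (- 1ℚ) ^ m * h (- s) t   ≡⟨ cong₂ _*_ (-[1]^-odd K) (h-even s t) ⟩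
    - 1ℚ * h s t             ≡⟨ -1*x≡-x (h s t) ⟩
    - h s t                  ∎
    where
    neg-neg : ∀ x → x ≡ - (- x)
    neg-neg = solve-∀ ℚ-ring
    -1*x≡-x : ∀ x → - 1ℚ * x ≡ - x
    -1*x≡-x = solve-∀ ℚ-ring

  d-odd₂ : ∀ s t → d s (- t) ≡ - d s t
  d-odd₂ s t = begin
    d s (- t)                ≡⟨ cong (λ z → d z (- t)) (neg-neg s) ⟩
    d (- (- s)) (- t)        ≡⟨ hom-neg-neg n (deriv C) (- s) t ⟩
    (- 1ℚ) ^ n * d (- s) t   ≡⟨ cong₂ _*_ (-[1]^-even K) (d-odd s t) ⟩
    1ℚ * - d s t             ≡⟨ ℚ.*-identityˡ _ ⟩
    - d s t                  ∎
    where
    neg-neg : ∀ x → x ≡ - (- x)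
    neg-neg = solve-∀ ℚ-ring

  module _ (a : ℚ) (q : Poly) (q-odd : OddPoly q) (LC≈ : L (2 ℕ.+ m) C ≈ₚ const a ⊕ q) where

    h-relation : ∀ s u v → u ≡ s + 1ℚ → v ≡ s - 1ℚ →
                 two * h s 1ℚ - h u 1ℚ - h u s - h v 1ℚ + h v s ≡ two * a
    h-relation s u v u≡ v≡ = begin
      two * h s 1ℚ - h u 1ℚ - h u s - h v 1ℚ + h v s
        ≡⟨ sym (hom-L-symmetrised m C s 1ℚ u v C≤m h-even h-odd₂ u≡ v≡) ⟩
      hom m LC s 1ℚ + hom m LC (- s) 1ℚ
        ≡⟨ cong₂ _+_ (hom-cong m LC (const a ⊕ q) s 1ℚ LC≈) (hom-cong m LC (const a ⊕ q) (- s) 1ℚ LC≈) ⟩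
      hom m (const a ⊕ q) s 1ℚ + hom m (const a ⊕ q) (- s) 1ℚ
        ≡⟨ cong₂ _+_ (hom-⊕ m (const a) q s 1ℚ) (hom-⊕ m (const a) q (- s) 1ℚ) ⟩
      (hom m (const a) s 1ℚ + hom m q s 1ℚ) + (hom m (const a) (- s) 1ℚ + hom m q (- s) 1ℚ)
        ≡⟨ cong₂ (λ x y → (x + hom m q s 1ℚ) + (y + hom m q (- s) 1ℚ))
                 (trans (hom-const m a s 1ℚ) a·1) (trans (hom-const m a (- s) 1ℚ) a·1) ⟩
      (a + hom m q s 1ℚ) + (a + hom m q (- s) 1ℚ)
        ≡⟨ cong (λ z → (a + hom m q s 1ℚ) + (a + z)) (hom-odd m q s 1ℚ q-odd) ⟩
      (a + hom m q s 1ℚ) + (a + - hom m q s 1ℚ)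
        ≡⟨ cancel a (hom m q s 1ℚ) ⟩
      two * a ∎
      where
      LC = L (2 ℕ.+ m) C
      a·1 : a * 1ℚ ^ m ≡ a
      a·1 = trans (cong (a *_) (1^n≡1 m)) (ℚ.*-identityʳ a)
      cancel : ∀ a x → (a + x) + (a + - x) ≡ two * a
      cancel = solve-∀ ℚ-ring

    private
      D : ℚ → ℚ → ℚ
      D = hom n (deriv (L (2 ℕ.+ m) C))

      D-even : ∀ s t → D (- s) t ≡ D s t
      D-even s t = begin
        D (- s) t                 ≡⟨ hom-cong n (deriv (L (2 ℕ.+ m) C)) (deriv q) (- s) t deriv-LC≈ ⟩
        hom n (deriv q) (- s) t   ≡⟨ hom-even n (deriv q) s t (EvenPoly-deriv q q-odd) ⟩
        hom n (deriv q) s t       ≡⟨ sym (hom-cong n (deriv (L (2 ℕ.+ m) C)) (deriv q) s t deriv-LC≈) ⟩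
        D s t                     ∎
        where
        deriv-LC≈ : deriv (L (2 ℕ.+ m) C) ≈ₚ deriv q
        deriv-LC≈ = ≈ₚ-trans {deriv (L (2 ℕ.+ m) C)} {deriv (const a ⊕ q)} {deriv q}
                             (deriv-cong {L (2 ℕ.+ m) C} {const a ⊕ q} LC≈) (deriv-⊕ (const a) q)

    d-relation : ∀ s t u v → u ≡ s + t → v ≡ s - t →
      two * s * d s t - s * d u t - s * d v t - fromℕ m * h u s + fromℕ m * h v s + t * d u s + t * d v s ≡ 0ℚ
    d-relation s t u v refl refl = begin
      two * s * d s t - s * d u t - s * d v t - M * h u s + M * h v s + t * d u s + t * d v s
        ≡⟨ regroup s t (d s t) (d u t) (d v t) M (h u s) (h v s) (d u s) (d v s) ⟩
      (s * d s t - s * d u t - (M * h u s - t * d u s)) +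
        (- s * - d s t - - s * - d v t - (M * - h v s - t * d v s))
        ≡⟨ cong₂ _+_ (sym (hom-deriv-L n C s t C≤m)) (sym reflected) ⟩
      s * D s t + - s * D (- s) t    ≡⟨ cong (λ z → s * D s t + - s * z) (D-even s t) ⟩
      s * D s t + - s * D s t        ≡⟨ cancel s (D s t) ⟩
      0ℚ                             ∎
      where
      M = fromℕ m
      -s+t≡-[s-t] : ∀ s t → - s + t ≡ - (s - t)
      -s+t≡-[s-t] = solve-∀ ℚ-ring
      neg-neg : ∀ x → x ≡ - (- x)
      neg-neg = solve-∀ ℚ-ring
      reflected : - s * D (- s) t ≡ - s * - d s t - - s * - d v t - (M * - h v s - t * d v s)
      reflected = begin
        - s * D (- s) t
          ≡⟨ hom-deriv-L n C (- s) t C≤m ⟩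
        - s * d (- s) t - - s * d (- s + t) t - (M * h (- s + t) (- s) - t * d (- s + t) (- s))
          ≡⟨ cong (λ z → - s * d (- s) t - - s * d z t - (M * h z (- s) - t * d z (- s))) (-s+t≡-[s-t] s t) ⟩
        - s * d (- s) t - - s * d (- v) t - (M * h (- v) (- s) - t * d (- v) (- s))
          ≡⟨ cong₂ (λ x y → - s * x - - s * y - (M * h (- v) (- s) - t * d (- v) (- s))) (d-odd s t) (d-odd v t) ⟩
        - s * - d s t - - s * - d v t - (M * h (- v) (- s) - t * d (- v) (- s))
          ≡⟨ cong₂ (λ x y → - s * - d s t - - s * - d v t - (M * x - t * y))
                   (trans (h-even v (- s)) (h-odd₂ v s))
                   (trans (d-odd v (- s)) (trans (cong -_ (d-odd₂ v s)) (sym (neg-neg (d v s))))) ⟩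
        - s * - d s t - - s * - d v t - (M * - h v s - t * d v s) ∎
      regroup : ∀ s t a b c M e f g i →
        two * s * a - s * b - s * c - M * e + M * f + t * g + t * i ≡
        (s * a - s * b - (M * e - t * g)) + (- s * - a - - s * - c - (M * - f - t * i))
      regroup = solve-∀ ℚ-ring
      cancel : ∀ s x → s * x + - s * x ≡ 0ℚ
      cancel = solve-∀ ℚ-ring

  module _ (p : Poly) (Xp≈ : Xₚ ⊗ p ≈ₚ (Xₚ ⊗ deriv C) ⊕ recip m (deriv C)) where

    Xp≤ : Deg≤ m (Xₚ ⊗ p)
    Xp≤ = Deg≤-resp-≈ m (Xₚ ⊗ p) ((Xₚ ⊗ deriv C) ⊕ recip m (deriv C)) Xp≈ (Deg≤-⊕ m (Xₚ ⊗ deriv C) (recip m (deriv C))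
                                   (Deg≤-X⊗ n (deriv C) C′≤) (Deg≤-recipFrom m 0 (deriv C)))

    hom-Xp : ∀ σ τ → hom m (Xₚ ⊗ p) σ τ ≡ homXp d σ τ
    hom-Xp σ τ = begin
      hom m (Xₚ ⊗ p) σ τ
        ≡⟨ hom-cong m (Xₚ ⊗ p) ((Xₚ ⊗ deriv C) ⊕ recip m (deriv C)) σ τ Xp≈ ⟩
      hom m ((Xₚ ⊗ deriv C) ⊕ recip m (deriv C)) σ τ
        ≡⟨ hom-⊕ m (Xₚ ⊗ deriv C) (recip m (deriv C)) σ τ ⟩
      hom m (Xₚ ⊗ deriv C) σ τ + hom m (recip m (deriv C)) σ τ
        ≡⟨ cong₂ _+_ (hom-X⊗ n (deriv C) σ τ)
                     (trans (hom-recip m (deriv C) σ τ (Deg≤-mono (deriv C) (ℕ.n≤1+n n) C′≤))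
                            (hom-raise n (deriv C) τ σ C′≤)) ⟩
      σ * d σ τ + σ * d τ σ
        ≡⟨ sym (ℚ.*-distribˡ-+ σ (d σ τ) (d τ σ)) ⟩
      homXp d σ τ ∎

    Xp-even : ∀ σ τ → hom m (Xₚ ⊗ p) (- σ) τ ≡ hom m (Xₚ ⊗ p) σ τ
    Xp-even σ τ = begin
      hom m (Xₚ ⊗ p) (- σ) τ           ≡⟨ hom-Xp (- σ) τ ⟩
      - σ * (d (- σ) τ + d τ (- σ))    ≡⟨ cong₂ (λ x y → - σ * (x + y)) (d-odd σ τ) (d-odd₂ τ σ) ⟩
      - σ * (- d σ τ + - d τ σ)        ≡⟨ neg*neg σ (d σ τ) (d τ σ) ⟩
      homXp d σ τ                      ≡⟨ sym (hom-Xp σ τ) ⟩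
      hom m (Xₚ ⊗ p) σ τ               ∎
      where
      neg*neg : ∀ s x y → - s * (- x + - y) ≡ s * (x + y)
      neg*neg = solve-∀ ℚ-ring

    Xp-odd₂ : ∀ σ τ → hom m (Xₚ ⊗ p) σ (- τ) ≡ - hom m (Xₚ ⊗ p) σ τ
    Xp-odd₂ σ τ = begin
      hom m (Xₚ ⊗ p) σ (- τ)           ≡⟨ hom-Xp σ (- τ) ⟩
      σ * (d σ (- τ) + d (- τ) σ)      ≡⟨ cong₂ (λ x y → σ * (x + y)) (d-odd₂ σ τ) (d-odd τ σ) ⟩
      σ * (- d σ τ + - d τ σ)          ≡⟨ pull-neg σ (d σ τ) (d τ σ) ⟩
      - homXp d σ τ                    ≡⟨ cong -_ (sym (hom-Xp σ τ)) ⟩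
      - hom m (Xₚ ⊗ p) σ τ             ∎
      where
      pull-neg : ∀ s x y → s * (- x + - y) ≡ - (s * (x + y))
      pull-neg = solve-∀ ℚ-ring

ConstPlusOdd-L[Xp] : ∀ K C → EvenPoly C → Deg≤ (2 ℕ.* K) C → ConstPlusOdd (L (3 ℕ.+ 2 ℕ.* K) C) →
  ∀ p → Xₚ ⊗ p ≈ₚ (Xₚ ⊗ deriv C) ⊕ recip (suc (2 ℕ.* K)) (deriv C) →
  ConstPlusOdd (L (3 ℕ.+ 2 ℕ.* K) (Xₚ ⊗ p))
ConstPlusOdd-L[Xp] K C C-even C≤ (a , q , q-odd , LC≈) p Xp≈ =
  ConstPlusOdd-from-symmetrisation m V (two * (two * a * fromℕ m)) (Deg≤-L m Xp (Xp≤ p Xp≈)) V-symmetrisation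
  where
  open Homogenised K C C-even C≤
  open Combination h d (fromℕ m) a h-even d-odd (h-relation a q q-odd LC≈) (d-relation a q q-odd LC≈)
  Xp = Xₚ ⊗ p
  V  = L (2 ℕ.+ m) Xp
  V-symmetrisation : ∀ i → hom m V (fromℕ i) 1ℚ + hom m V (- fromℕ i) 1ℚ ≡ two * (two * a * fromℕ m)
  V-symmetrisation i = begin
    hom m V x 1ℚ + hom m V (- x) 1ℚ
      ≡⟨ hom-L-symmetrised m Xp x 1ℚ (x + 1ℚ) (x - 1ℚ) (Xp≤ p Xp≈) (Xp-even p Xp≈) (Xp-odd₂ p Xp≈) refl refl ⟩
    two * f x 1ℚ - f (x + 1ℚ) 1ℚ - f (x + 1ℚ) x - f (x - 1ℚ) 1ℚ + f (x - 1ℚ) x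
      ≡⟨ cong₅ (hom-Xp p Xp≈ x 1ℚ) (hom-Xp p Xp≈ (x + 1ℚ) 1ℚ) (hom-Xp p Xp≈ (x + 1ℚ) x)
               (hom-Xp p Xp≈ (x - 1ℚ) 1ℚ) (hom-Xp p Xp≈ (x - 1ℚ) x) ⟩
    two * G x 1ℚ - G (x + 1ℚ) 1ℚ - G (x + 1ℚ) x - G (x - 1ℚ) 1ℚ + G (x - 1ℚ) x
      ≡⟨ G-relation x ⟩
    two * (two * a * fromℕ m) ∎
    where
    x = fromℕ i
    f = hom m Xp
    G = homXp d
    cong₅ : ∀ {a a′ b b′ c c′ e e′ g g′} → a ≡ a′ → b ≡ b′ → c ≡ c′ → e ≡ e′ → g ≡ g′ →
            two * a - b - c - e + g ≡ two * a′ - b′ - c′ - e′ + g′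
    cong₅ refl refl refl refl refl = refl

OddPoly-evenPolyFrom : ∀ cs → OddPoly (evenPolyFrom cs)
OddPoly-evenPolyFrom []       k       = refl
OddPoly-evenPolyFrom (c ∷ cs) zero    = refl
OddPoly-evenPolyFrom (c ∷ cs) (suc k) =
  trans (cong (coeff (evenPolyFrom (c ∷ cs))) (2*suc k)) (OddPoly-evenPolyFrom cs k)

length-evenPolyFrom : ∀ cs → length (evenPolyFrom cs) ≡ 2 ℕ.* length cs
length-evenPolyFrom []       = refl
length-evenPolyFrom (c ∷ cs) = trans (cong (λ z → suc (suc z)) (length-evenPolyFrom cs)) (sym (2*suc (length cs)))

odd⇒≡2*half : ∀ r → (3 ℕ.+ r) % 2 ≡ 1 → r ≡ 2 ℕ.* (r / 2)
odd⇒≡2*half zero          _    = refl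
odd⇒≡2*half (suc (suc r)) odd = begin
  2 ℕ.+ r                 ≡⟨ cong (2 ℕ.+_) (odd⇒≡2*half r (trans (sym (ℕ.[m+n]%n≡m%n (3 ℕ.+ r) 2)) shift)) ⟩
  2 ℕ.+ 2 ℕ.* (r / 2)     ≡⟨ sym (ℕ.*-suc 2 (r / 2)) ⟩
  2 ℕ.* suc (r / 2)       ≡⟨ cong (2 ℕ.*_) (sym (ℕ.m/n≡1+[m∸n]/n {2 ℕ.+ r} {2} (s≤s (s≤s z≤n)))) ⟩
  2 ℕ.* ((2 ℕ.+ r) / 2)   ∎
  where
  shift : (3 ℕ.+ r ℕ.+ 2) % 2 ≡ 1
  shift = trans (cong (_% 2) (trans (ℕ.+-assoc 3 r 2) (cong (3 ℕ.+_) (ℕ.+-comm r 2)))) odd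

lemma3 : (N : ℕ) → 5 ≤ N → N % 2 ≡ 1 →
         (c : Vec ℚ ((N ∸ 3) / 2)) →
         let C = evenPoly (toList c) in
         ConstPlusOdd (L N C) →
         (p : Poly) →
         (Xₚ ⊗ p ≈ₚ (Xₚ ⊗ deriv C) ⊕ recip (N ∸ 2) (deriv C)) →
         ConstPlusOdd (L N (Xₚ ⊗ p))
lemma3 (suc (suc (suc r))) (s≤s (s≤s (s≤s _))) N-odd c L[C] p Xp≈ =
  subst (λ M → ConstPlusOdd (L M C) → Xₚ ⊗ p ≈ₚ (Xₚ ⊗ deriv C) ⊕ recip (M ∸ 2) (deriv C) →
               ConstPlusOdd (L M (Xₚ ⊗ p)))
        (cong (3 ℕ.+_) (sym (odd⇒≡2*half r N-odd)))
        (λ L[C]′ Xp≈′ → ConstPlusOdd-L[Xp] K C C-even C≤ L[C]′ p Xp≈′) L[C] Xp≈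
  where
  K = r / 2
  C = evenPoly (toList c)
  C-even : EvenPoly C
  C-even = OddPoly-evenPolyFrom (toList c)
  C≤ : Deg≤ (2 ℕ.* K) C
  C≤ = Deg≤-length (2 ℕ.* K) C (ℕ.≤-reflexive (cong suc
         (trans (length-evenPolyFrom (toList c)) (cong (2 ℕ.*_) (Vec.length-toList c)))))
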